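{- Let $v,w$ be integers with $2\le v\le w$, and let $D=(P_1,\dots,P_{w+2})\in\mathfrak D'_{w+2}$ with the $P_i$ pairwise distinct and $|P_i|=0$ for $i=1,2$; $|P_i|=i-2$ for $3\le i\le w-v+3$; $|P_i|=i-3$ for $w-v+4\le i\le w+2$. Then the leading term of $\varphi(D)$ is $-(|P_1|_y-|P_2|_y)(|P_{w-v+3}|_y-|P_{w-v+4}|_y)\,\rho_v\rho_w$; in particular $\mathrm{LM}(\varphi(D))=\rho_v\rho_w$.
   Context: For a point $P=(a,b)$, $|P|=a+b$, $|P|_y=b$. $\mathfrak D'_m$ is the set of $m$-tuples $(P_1,\dots,P_m)$ of points $(a_i,b_i)$ with $a_i\in\mathbb Z$, $b_i\in\mathbb N$, $a_i+b_i\ge0$, listed in increasing order, where $(a,b)<(a',b')$ iff $a+b<a'+b'$, or $a+b=a'+b'$ and $a<a'$. $\rho_i$ has weight $i$, $\rho_0=1$; $h(b,w)$ is the weight-$w$ part of $(1+\rho_1+\rho_2+\cdots)^b$ ($0$ if $w<0$; $(\cdots)^0=1$). $\varphi(D)=(-1)^k\det[h(b_i,j-1-|P_i|)]_{1\le i,j\le m}$ with $k=\binom m2-\sum|P_i|$; it is a polynomial in the $\rho_i$ homogeneous of weight $k$. Monomials of equal weight are ordered by $\rho_\nu<\rho_\mu$ (indices written as nondecreasing sequences) if for some $j$, $\nu_i=\mu_i$ for $i<j$ and $\nu_j<\mu_j$; the leading term of a nonzero $f=\sum a_\nu\rho_\nu$ is $a_\nu\rho_\nu$ for the largest $\rho_\nu$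 with $a_\nu\ne0$, and $\mathrm{LM}(f)$ is that monomial. -}

module Defs where

open import Data.Nat as ℕ using (ℕ; zero; suc; _≤?_)
open import Data.Nat.Combinatorics using (_C_)
open import Data.Integer as ℤ using (ℤ; +_; -[1+_]; _+_; _-_; _*_; -_)
open import Data.Fin using (Fin; toℕ; punchIn) renaming (zero to fzero; suc to fsuc)
open import Data.Nat.ListAction using (sum)
open import Data.List using (List; []; _∷_; map; concatMap; foldr; allFin; upTo; lookup; length; tabulate)
open import Data.List.Properties using (≡-dec)
open import Data.List.Relation.Unary.All using (All)
open import Data.List.Relation.Unary.Linked using (Linked)
open import Data.Product using (_×_; _,_; proj₁; proj₂)
open import Data.Sum using (_⊎_)
open import Data.Bool using (if_then_else_)
open import Relation.Nullary using (does)
open import Relation.Binary.PropositionalEquality using (_≡_)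

-- A monomial ρ_ν is represented by its index list ν written as a
-- nondecreasing sequence of positive naturals (ρ₀ = 1 is the empty list).
-- A polynomial is a formal (unnormalised) sum of terms c·ρ_ν.

Monomial : Set
Monomial = List ℕ

Poly : Set
Poly = List (ℤ × Monomial)

zeroP : Poly
zeroP = []

oneP : Poly
oneP = (+ 1 , []) ∷ []

_+P_ : Poly → Poly → Poly
f +P g = Data.List._++_ f g

negP : Poly → Poly
negP = map (λ t → (- proj₁ t , proj₂ t))

scaleP : ℤ → Poly → Poly
scaleP c = map (λ t → (c * proj₁ t , proj₂ t))

mulM : Monomial → Monomial → Monomial
mulM = Data.List.merge _≤?_

_*P_ : Poly → Poly → Poly
f *P g = concatMap (λ s → map (λ t → (proj₁ s * proj₁ t , mulM (proj₂ s) (proj₂ t))) g) f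

sumP : List Poly → Poly
sumP = foldr _+P_ zeroP

ρ : ℕ → Poly
ρ zero    = oneP
ρ (suc j) = (+ 1 , suc j ∷ []) ∷ []

coeff : Poly → Monomial → ℤ
coeff []            μ = + 0
coeff ((c , ν) ∷ f) μ = (if does (≡-dec ℕ._≟_ ν μ) then c else + 0) + coeff f μ

weight : Monomial → ℕ
weight = sum

IsMonomial : Monomial → Set
IsMonomial μ = All (λ x → 1 ℕ.≤ x) μ × Linked ℕ._≤_ μ

-- Monomial order (on monomials of equal weight): ρ_ν < ρ_μ iff for some j,
-- ν_i = μ_i for i < j and ν_j < μ_j.
data _<M_ : Monomial → Monomial → Set where
  here  : ∀ {x y xs ys} → x ℕ.< y → (x ∷ xs) <M (y ∷ ys)
  there : ∀ {x xs ys} → xs <M ys → (x ∷ xs) <M (x ∷ ys)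

-- h(b,w): weight-w part of (1 + ρ₁ + ρ₂ + ⋯)^b

hN : ℕ → ℕ → Poly
hN zero    zero    = oneP
hN zero    (suc _) = zeroP
hN (suc b) w       = sumP (map (λ j → ρ j *P hN b (w ℕ.∸ j)) (upTo (suc w)))

h : ℕ → ℤ → Poly
h b (+ w)      = hN b w
h b -[1+ _ ]   = zeroP

sgnFin : ∀ {n} → Fin n → ℤ
sgnFin fzero    = + 1
sgnFin (fsuc j) = - sgnFin j

det : ∀ n → (Fin n → Fin n → Poly) → Poly
det zero    A = oneP
det (suc n) A =
  sumP (map (λ j → scaleP (sgnFin j) (A fzero j *P det n (λ r c → A (fsuc r) (punchIn j c))))
            (allFin (suc n)))

Point : Set
Point = ℤ × ℕ

∣_∣P : Point → ℤ
∣ (a , b) ∣P = a + + b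

∣_∣y : Point → ℤ
∣ (a , b) ∣y = + b

ValidPoint : Point → Set
ValidPoint P = + 0 ℤ.≤ ∣ P ∣P

_<P_ : Point → Point → Set
P <P Q = (∣ P ∣P ℤ.< ∣ Q ∣P) ⊎ (∣ P ∣P ≡ ∣ Q ∣P × proj₁ P ℤ.< proj₁ Q)

_≤P_ : Point → Point → Set
P ≤P Q = P <P Q ⊎ P ≡ Q

In𝔇' : ∀ m → (Fin m → Point) → Set
In𝔇' m D = (∀ i → ValidPoint (D i)) × (∀ i j → toℕ i ℕ.< toℕ j → D i ≤P D j)

sumℤ : List ℤ → ℤ
sumℤ = foldr _+_ (+ 0)

kOf : ∀ m → (Fin m → Point) → ℤ
kOf m D = + (m C 2) - sumℤ (map (λ i → ∣ D i ∣P) (allFin m))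

parity : ℕ → ℤ
parity zero          = + 1
parity (suc zero)    = - (+ 1)
parity (suc (suc n)) = parity n

signPow : ℤ → ℤ
signPow k = parity ℤ.∣ k ∣

-- matrix entry (0-based i, j): h(b_i, (j+1) - 1 - |P_i|)
φ : ∀ m → (Fin m → Point) → Poly
φ m D = scaleP (signPow (kOf m D))
               (det m (λ i j → h (proj₂ (D i)) (+ toℕ j - ∣ D i ∣P)))

-- |P_n|_y for the 1-based index n (0 if n is out of range; only used in range)
yAt : ∀ {m} → (Fin m → Point) → ℕ → ℤ
yAt {zero}  D n       = + 0
yAt {suc m} D zero    = + 0
yAt {suc m} D (suc zero) = ∣ D fzero ∣y
yAt {suc m} D (suc (suc n)) = yAt {m} (λ i → D (fsuc i)) (suc n)

module Submission where

-- φ(D) = ±det[h(b_r, c − σ_r)] with b_r = |P_{r+1}|_y and σ_r = |P_{r+1}|, so that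
-- σ = (0, 0, 1, …, a, a, a + 1, …, w − 1) with a = w − v + 1; the two repeated values of σ drive the argument.
--
-- Laplace expansion meets the two rows with σ = a in distinct columns; at most one of them is the diagonal
-- column a (entry 1), and every other entry of these rows has weight between 1 and v. So every monomial of
-- the determinant contains some ρ_j with j ≤ v, and all coefficients above ρ_v ρ_w vanish.
--
-- For ρ_v ρ_w itself, expand along the first rows. The two rows with σ = 0 contribute one factor
-- b₀ ρ_w or b₁ ρ_w between them, with opposite signs. The staircase rows that follow contribute 1 each,
-- and the block starting at the rows p, p + 1 with σ = a contributes ±(b_p − b_{p+1}) ρ_v. Finally
-- k = C(w+2, 2) − ∑ σ = v + w, and all the signs multiply to −1.

open import Defs

open import Data.Bool using (true; false; T)
open import Data.Empty using (⊥-elim)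
open import Data.Fin using (Fin; toℕ; punchIn; fromℕ; fromℕ<; inject₁) renaming (zero to fzero; suc to fsuc)
import Data.Fin.Properties as FinP
open import Data.Integer as ℤ using (ℤ; +_; -_; _-_; _*_; 0ℤ; 1ℤ)
import Data.Integer.Properties as ℤP
open import Data.Integer.Tactic.RingSolver using (solve-∀)
open import Data.List using ([]; _∷_; map; tabulate; allFin; length; applyUpTo)
import Data.List.Properties as ListP
open import Data.List.Relation.Binary.Permutation.Propositional using (↭-sym)
open import Data.List.Relation.Binary.Permutation.Propositional.Properties using (merge-↭; ↭-length; Any-resp-↭)
open import Data.List.Relation.Binary.Sublist.Propositional using (_⊆_; []; _∷_; _∷ʳ_)
open import Data.List.Relation.Unary.All as All using (All; []; _∷_)
import Data.List.Relation.Unary.All.Properties as AllP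
open import Data.List.Relation.Unary.Any using (Any; here)
import Data.List.Relation.Unary.Any.Properties as AnyP
open import Data.List.Relation.Unary.Linked.Properties using (Linked⇒All)
open import Data.Nat as ℕ using (ℕ; zero; suc; _+_; _∸_; _≤_; _<_; z≤n; s≤s)
open import Data.Nat.Combinatorics using (_C_; nC1≡n; nCk+nC[k+1]≡[n+1]C[k+1])
open import Data.Nat.ListAction.Properties using (sum-↭; sum-++)
import Data.Nat.Properties as ℕP
open import Data.Product using (_×_; _,_; proj₁; proj₂; ∃; map₂)
open import Data.Sum using (_⊎_; inj₁; inj₂)
open import Data.Unit using (⊤; tt)
open import Data.Vec.Functional using (removeAt)
open import Function using (_∘′_; id)
open import Relation.Binary.Definitions using (tri<; tri≈; tri>)
open import Relation.Binary.PropositionalEquality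
open import Data.List.Relation.Binary.Sublist.Setoid.Properties (setoid ℕ) using (⊆-mergeˡ)
open import Relation.Nullary using (yes; no)
open import Algebra.Properties.CommutativeMonoid.Sum ℤP.+-0-commutativeMonoid
  using (sum-cong-≗; sum-remove; sum-replicate-zero; sum-init-last; ∑-distrib-+) renaming (sum to ∑)

coeff-∷-≡ : ∀ c ν f → coeff ((c , ν) ∷ f) ν ≡ c ℤ.+ coeff f ν
coeff-∷-≡ c ν f with ListP.≡-dec ℕ._≟_ ν ν
... | yes _  = refl
... | no ν≢ν = ⊥-elim (ν≢ν refl)

coeff-∷-≢ : ∀ c ν f μ → ν ≢ μ → coeff ((c , ν) ∷ f) μ ≡ coeff f μ
coeff-∷-≢ c ν f μ ν≢μ with ListP.≡-dec ℕ._≟_ ν μ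
... | yes ν≡μ = ⊥-elim (ν≢μ ν≡μ)
... | no _    = ℤP.+-identityˡ _

coeff-+P : ∀ f g μ → coeff (f +P g) μ ≡ coeff f μ ℤ.+ coeff g μ
coeff-+P []            g μ = sym (ℤP.+-identityˡ _)
coeff-+P ((c , ν) ∷ f) g μ with ListP.≡-dec ℕ._≟_ ν μ
... | yes _ = trans (cong (λ z → c ℤ.+ z) (coeff-+P f g μ)) (sym (ℤP.+-assoc c (coeff f μ) (coeff g μ)))
... | no _  = trans (cong (λ z → 0ℤ ℤ.+ z) (coeff-+P f g μ)) (sym (ℤP.+-assoc 0ℤ (coeff f μ) (coeff g μ)))

coeff-scaleP : ∀ a f μ → coeff (scaleP a f) μ ≡ a * coeff f μ
coeff-scaleP a [] μ = sym (ℤP.*-zeroʳ a)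
coeff-scaleP a ((c , ν) ∷ f) μ with ListP.≡-dec ℕ._≟_ ν μ
... | yes _ = trans (cong (λ z → a * c ℤ.+ z) (coeff-scaleP a f μ)) (sym (ℤP.*-distribˡ-+ a c _))
... | no _  = trans (ℤP.+-identityˡ _) (trans (coeff-scaleP a f μ) (cong (a *_) (sym (ℤP.+-identityˡ _))))

coeff-sumP-map-tabulate : ∀ {A : Set} {n} (F : A → Poly) (g : Fin n → A) μ →
  coeff (sumP (map F (tabulate g))) μ ≡ ∑ (λ j → coeff (F (g j)) μ)
coeff-sumP-map-tabulate {n = zero}  F g μ = refl
coeff-sumP-map-tabulate {n = suc n} F g μ = trans (coeff-+P (F (g fzero)) _ μ)
  (cong (λ z → coeff (F (g fzero)) μ ℤ.+ z) (coeff-sumP-map-tabulate F (λ j → g (fsuc j)) μ))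

coeff-sumP-map-applyUpTo : ∀ (F : ℕ → Poly) (f : ℕ → ℕ) n μ →
  coeff (sumP (map F (applyUpTo f n))) μ ≡ ∑ (λ (j : Fin n) → coeff (F (f (toℕ j))) μ)
coeff-sumP-map-applyUpTo F f zero    μ = refl
coeff-sumP-map-applyUpTo F f (suc n) μ = trans (coeff-+P (F (f 0)) _ μ)
  (cong (λ z → coeff (F (f 0)) μ ℤ.+ z) (coeff-sumP-map-applyUpTo F (λ j → f (suc j)) n μ))

length-mulM : ∀ ν ν′ → length (mulM ν ν′) ≡ length ν + length ν′
length-mulM ν ν′ = trans (↭-length (merge-↭ ℕ._≤?_ ν ν′)) (ListP.length-++ ν)

weight-mulM : ∀ ν ν′ → weight (mulM ν ν′) ≡ weight ν + weight ν′
weight-mulM ν ν′ = trans (sum-↭ (merge-↭ ℕ._≤?_ ν ν′)) (sum-++ ν ν′)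

weight-[x] : ∀ x → weight (x ∷ []) ≡ x
weight-[x] = ℕP.+-identityʳ

Any-mulMˡ : ∀ {P : ℕ → Set} ν ν′ → Any P ν → Any P (mulM ν ν′)
Any-mulMˡ ν ν′ p = Any-resp-↭ (↭-sym (merge-↭ ℕ._≤?_ ν ν′)) (AnyP.++⁺ˡ p)

Any-mulMʳ : ∀ {P : ℕ → Set} ν ν′ → Any P ν′ → Any P (mulM ν ν′)
Any-mulMʳ ν ν′ p = Any-resp-↭ (↭-sym (merge-↭ ℕ._≤?_ ν ν′)) (AnyP.++⁺ʳ ν p)

⊆-mulMˡ : ∀ ν ν′ → ν ⊆ mulM ν ν′
⊆-mulMˡ = ⊆-mergeˡ ℕ._≤?_

mulM≢[] : ∀ {ν} ν′ → ν ≢ [] → mulM ν ν′ ≢ []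
mulM≢[] {[]}    ν′ ν≢[] _ = ν≢[] refl
mulM≢[] {x ∷ ν} ν′ _ e with () ← trans (sym (length-mulM (x ∷ ν) ν′)) (cong length e)

≤ᵇ-refl≢false : ∀ {x} → (x ℕ.≤ᵇ x) ≢ false
≤ᵇ-refl≢false {x} e = subst T e (ℕP.≤⇒≤ᵇ (ℕP.≤-refl {x}))

mulM-[x]-injective : ∀ x {ν ν′} → mulM (x ∷ []) ν ≡ mulM (x ∷ []) ν′ → ν ≡ ν′
mulM-[x]-injective x {[]}    {[]}     _ = refl
mulM-[x]-injective x {[]}    {y ∷ ν′} e with x ℕ.≤ᵇ y
... | true  with () ← e
... | false = ⊥-elim (mulM≢[] {x ∷ []} ν′ (λ ()) (sym (proj₂ (ListP.∷-injective e))))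
mulM-[x]-injective x {y ∷ ν} {[]}     e with x ℕ.≤ᵇ y
... | true  with () ← e
... | false = ⊥-elim (mulM≢[] {x ∷ []} ν (λ ()) (proj₂ (ListP.∷-injective e)))
mulM-[x]-injective x {y ∷ ν} {z ∷ ν′} e with x ℕ.≤ᵇ y in x≤ᵇy | x ℕ.≤ᵇ z in x≤ᵇz
... | true  | true  = proj₂ (ListP.∷-injective e)
... | true  | false with refl ← proj₁ (ListP.∷-injective e) = ⊥-elim (≤ᵇ-refl≢false {x} x≤ᵇz)
... | false | true  with refl ← proj₁ (ListP.∷-injective e) = ⊥-elim (≤ᵇ-refl≢false {x} x≤ᵇy)
... | false | false =
  cong₂ _∷_ (proj₁ (ListP.∷-injective e)) (mulM-[x]-injective x (proj₂ (ListP.∷-injective e)))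

mulM-[x]-[y] : ∀ {x y} → x ≤ y → mulM (x ∷ []) (y ∷ []) ≡ x ∷ y ∷ []
mulM-[x]-[y] {x} {y} x≤y with x ℕ.≤ᵇ y in x≤ᵇy
... | true  = refl
... | false = ⊥-elim (subst T x≤ᵇy (ℕP.≤⇒≤ᵇ x≤y))

mulM-[y]-[x] : ∀ {x y} → x ≤ y → mulM (y ∷ []) (x ∷ []) ≡ x ∷ y ∷ []
mulM-[y]-[x] {x} {y} x≤y with y ℕ.≤ᵇ x in y≤ᵇx
... | true  = cong₂ (λ u z → u ∷ z ∷ []) y≡x (sym y≡x)
  where
  y≡x : y ≡ x
  y≡x = ℕP.≤-antisym (ℕP.≤ᵇ⇒≤ y x (subst T (sym y≤ᵇx) _)) x≤y
... | false = refl

AllMonomials : (Monomial → Set) → Poly → Set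
AllMonomials P = All (λ t → P (proj₂ t))

coeff-≡0 : ∀ {f μ} → AllMonomials (_≢ μ) f → coeff f μ ≡ 0ℤ
coeff-≡0 {[]}          []          = refl
coeff-≡0 {(c , ν) ∷ f} (ν≢μ ∷ νs≢μ) = trans (coeff-∷-≢ c ν f _ ν≢μ) (coeff-≡0 νs≢μ)

AllMonomials-sumP : ∀ {P} fs → All (AllMonomials P) fs → AllMonomials P (sumP fs)
AllMonomials-sumP []       []         = []
AllMonomials-sumP (f ∷ fs) (pf ∷ pfs) = AllP.++⁺ pf (AllMonomials-sumP fs pfs)

AllMonomials-scaleP : ∀ {P} a f → AllMonomials P f → AllMonomials P (scaleP a f)
AllMonomials-scaleP a f = AllP.map⁺ ∘′ All.map id

AllMonomials-*P : ∀ {P Q R : Monomial → Set} f g → (∀ {ν ν′} → P ν → Q ν′ → R (mulM ν ν′)) →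
  AllMonomials P f → AllMonomials Q g → AllMonomials R (f *P g)
AllMonomials-*P f g PQ⇒R pf qg =
  AllP.concat⁺ (AllP.map⁺ (All.map (λ p → AllP.map⁺ (All.map (PQ⇒R p) qg)) pf))

coeff-*P-≡0 : ∀ {P Q : Monomial → Set} f g μ → (∀ {ν ν′} → P ν → Q ν′ → mulM ν ν′ ≢ μ) →
  AllMonomials P f → AllMonomials Q g → coeff (f *P g) μ ≡ 0ℤ
coeff-*P-≡0 f g μ PQ⇒≢ pf qg = coeff-≡0 (AllMonomials-*P f g PQ⇒≢ pf qg)

coeff-*P-factor : ∀ f g {μ} ν₀ μ′ → mulM ν₀ μ′ ≡ μ →
  (∀ ν′ → mulM ν₀ ν′ ≡ μ → ν′ ≡ μ′) → AllMonomials (λ ν → ν ≡ ν₀ ⊎ (∀ ν′ → mulM ν ν′ ≢ μ)) f →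
  coeff (f *P g) μ ≡ coeff f ν₀ * coeff g μ′
coeff-*P-factor [] g ν₀ μ′ _ _ [] = refl
coeff-*P-factor ((c , ν) ∷ f) g {μ} ν₀ μ′ ν₀μ′≡μ unique (p ∷ ps) =
  trans (coeff-+P (row g) (f *P g) μ) (step p)
  where
  row : Poly → Poly
  row = map (λ t → (c * proj₁ t , mulM ν (proj₂ t)))
  rest : coeff (f *P g) μ ≡ coeff f ν₀ * coeff g μ′
  rest = coeff-*P-factor f g ν₀ μ′ ν₀μ′≡μ unique ps
  row-factor : ν ≡ ν₀ → ∀ g → coeff (row g) μ ≡ c * coeff g μ′
  row-factor _ [] = sym (ℤP.*-zeroʳ c)
  row-factor refl ((d , ν′) ∷ g) with ListP.≡-dec ℕ._≟_ (mulM ν ν′) μ | ListP.≡-dec ℕ._≟_ ν′ μ′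
  ... | yes _ | yes _    = trans (cong (λ z → c * d ℤ.+ z) (row-factor refl g)) (sym (ℤP.*-distribˡ-+ c d _))
  ... | yes e | no ν′≢μ′ = ⊥-elim (ν′≢μ′ (unique ν′ e))
  ... | no ≢μ | yes refl = ⊥-elim (≢μ ν₀μ′≡μ)
  ... | no _  | no _     = trans (ℤP.+-identityˡ _)
                                 (trans (row-factor refl g) (cong (c *_) (sym (ℤP.+-identityˡ _))))
  row-vanishes : (∀ ν′ → mulM ν ν′ ≢ μ) → coeff (row g) μ ≡ 0ℤ
  row-vanishes ≢μ = coeff-≡0 (AllP.map⁺ (All.universal (λ t → ≢μ (proj₂ t)) g))
  step : ν ≡ ν₀ ⊎ (∀ ν′ → mulM ν ν′ ≢ μ) →
    coeff (row g) μ ℤ.+ coeff (f *P g) μ ≡ coeff ((c , ν) ∷ f) ν₀ * coeff g μ′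
  step (inj₁ refl) = begin
    coeff (row g) μ ℤ.+ coeff (f *P g) μ       ≡⟨ cong₂ ℤ._+_ (row-factor refl g) rest ⟩
    c * coeff g μ′ ℤ.+ coeff f ν * coeff g μ′  ≡⟨ ℤP.*-distribʳ-+ (coeff g μ′) c (coeff f ν) ⟨
    (c ℤ.+ coeff f ν) * coeff g μ′             ≡⟨ cong (_* coeff g μ′) (coeff-∷-≡ c ν f) ⟨
    coeff ((c , ν) ∷ f) ν * coeff g μ′         ∎
    where open ≡-Reasoning
  step (inj₂ ≢μ) = begin
    coeff (row g) μ ℤ.+ coeff (f *P g) μ       ≡⟨ cong₂ ℤ._+_ (row-vanishes ≢μ) rest ⟩
    0ℤ ℤ.+ coeff f ν₀ * coeff g μ′             ≡⟨ ℤP.+-identityˡ _ ⟩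
    coeff f ν₀ * coeff g μ′                    ≡⟨ cong (_* coeff g μ′) (coeff-∷-≢ c ν f ν₀ ν≢ν₀) ⟨
    coeff ((c , ν) ∷ f) ν₀ * coeff g μ′        ∎
    where
    open ≡-Reasoning
    ν≢ν₀ : ν ≢ ν₀
    ν≢ν₀ refl = ≢μ μ′ ν₀μ′≡μ

coeff-oneP-*P : ∀ g μ → coeff (oneP *P g) μ ≡ coeff g μ
coeff-oneP-*P g μ =
  trans (coeff-*P-factor oneP g [] μ refl (λ _ → id) (inj₁ refl ∷ [])) (ℤP.*-identityˡ _)

∑-single : ∀ {n} (f : Fin n → ℤ) j₀ → (∀ j → j ≢ j₀ → f j ≡ 0ℤ) → ∑ f ≡ f j₀
∑-single {suc n} f j₀ others = begin
  ∑ f                        ≡⟨ sum-remove {i = j₀} f ⟩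
  f j₀ ℤ.+ ∑ (removeAt f j₀) ≡⟨ cong (λ z → f j₀ ℤ.+ z) removed≡0 ⟩
  f j₀ ℤ.+ 0ℤ                ≡⟨ ℤP.+-identityʳ (f j₀) ⟩
  f j₀                       ∎
  where
  open ≡-Reasoning
  removed≡0 : ∑ (removeAt f j₀) ≡ 0ℤ
  removed≡0 = trans (sum-cong-≗ (λ j → others _ (FinP.punchInᵢ≢i j₀ j))) (sum-replicate-zero n)

∑-two : ∀ {n} (f : Fin (suc n) → ℤ) j₁ → (∀ j → j ≢ fzero → j ≢ fsuc j₁ → f j ≡ 0ℤ) →
  ∑ f ≡ f fzero ℤ.+ f (fsuc j₁)
∑-two f j₁ others = cong (λ z → f fzero ℤ.+ z)
  (∑-single (λ j → f (fsuc j)) j₁ (λ j j≢j₁ → others (fsuc j) (λ ()) (j≢j₁ ∘′ FinP.suc-injective)))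

-- The polynomials h(b, n)

hN-zero : ∀ b → hN b 0 ≡ oneP
hN-zero zero    = refl
hN-zero (suc b) rewrite hN-zero b = refl

ρ-homogeneous : ∀ j → AllMonomials (λ ν → weight ν ≡ j) (ρ j)
ρ-homogeneous zero    = refl ∷ []
ρ-homogeneous (suc j) = cong suc (ℕP.+-identityʳ j) ∷ []

hN-homogeneous : ∀ b n → AllMonomials (λ ν → weight ν ≡ n) (hN b n)
hN-homogeneous zero    zero    = refl ∷ []
hN-homogeneous zero    (suc n) = []
hN-homogeneous (suc b) n =
  AllMonomials-sumP _ (AllP.map⁺ (AllP.applyUpTo⁺₁ id (suc n) (λ j<1+n → summand (ℕ.s≤s⁻¹ j<1+n))))
  where
  summand : ∀ {j} → j ≤ n → AllMonomials (λ ν → weight ν ≡ n) (ρ j *P hN b (n ∸ j))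
  summand {j} j≤n = AllMonomials-*P (ρ j) (hN b (n ∸ j))
    (λ {ν} {ν′} wν wν′ → trans (weight-mulM ν ν′) (trans (cong₂ _+_ wν wν′) (ℕP.m+[n∸m]≡n j≤n)))
    (ρ-homogeneous j) (hN-homogeneous b (n ∸ j))

-- In h(b+1, n) = ∑_j ρ_j h(b, n−j), the monomial ρ_n comes only from j = 0 and j = n.
coeff-hN-[n] : ∀ b e → coeff (hN b (suc e)) (suc e ∷ []) ≡ + b
coeff-hN-[n] zero    e = refl
coeff-hN-[n] (suc b) e = begin
  coeff (hN (suc b) (suc e)) μ
    ≡⟨ coeff-sumP-map-applyUpTo F id (suc (suc e)) μ ⟩
  coeff (oneP *P hN b (suc e)) μ ℤ.+ ∑ G′
    ≡⟨ cong₂ ℤ._+_ (coeff-oneP-*P (hN b (suc e)) μ) (∑-single G′ (fromℕ e) G-vanishes) ⟩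
  coeff (hN b (suc e)) μ ℤ.+ G (toℕ (fromℕ e))
    ≡⟨ cong₂ ℤ._+_ (coeff-hN-[n] b e) (cong G (FinP.toℕ-fromℕ e)) ⟩
  + b ℤ.+ G e
    ≡⟨ cong (λ z → + b ℤ.+ z) G-top ⟩
  + (b + 1)
    ≡⟨ cong +_ (ℕP.+-comm b 1) ⟩
  + suc b
    ∎
  where
  open ≡-Reasoning
  μ : Monomial
  μ = suc e ∷ []
  F : ℕ → Poly
  F j = ρ j *P hN b (suc e ∸ j)
  G : ℕ → ℤ
  G j = coeff (F (suc j)) μ
  G′ : Fin (suc e) → ℤ
  G′ j = G (toℕ j)
  G-top : G e ≡ 1ℤ
  G-top rewrite ℕP.n∸n≡0 e | hN-zero b = coeff-∷-≡ 1ℤ μ []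
  G-vanishes : ∀ j → j ≢ fromℕ e → G′ j ≡ 0ℤ
  G-vanishes j j≢e =
    coeff-*P-≡0 {P = _≡ [j]} {Q = λ _ → ⊤} (ρ (suc (toℕ j))) (hN b (e ∸ toℕ j)) μ
      (λ { {ν′ = ν′} refl _ [j]ν′≡μ →
             j≢e (⊆μ⇒j≡e (subst ([j] ⊆_) [j]ν′≡μ (⊆-mulMˡ [j] ν′))) })
      (refl ∷ []) (All.universal _ _)
    where
    [j] : Monomial
    [j] = suc (toℕ j) ∷ []
    ⊆μ⇒j≡e : [j] ⊆ μ → j ≡ fromℕ e
    ⊆μ⇒j≡e (j≡e ∷ []) = FinP.toℕ-injective (trans (ℕP.suc-injective j≡e) (sym (FinP.toℕ-fromℕ e)))

coeff-hN*P-factor : ∀ b e g {μ} μ′ → mulM (suc e ∷ []) μ′ ≡ μ →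
  (∀ {ν} → ν ⊆ μ → weight ν ≡ suc e → ν ≡ suc e ∷ []) →
  coeff (hN b (suc e) *P g) μ ≡ + b * coeff g μ′
coeff-hN*P-factor b e g {μ} μ′ [n]μ′≡μ only =
  trans (coeff-*P-factor (hN b (suc e)) g (suc e ∷ []) μ′ [n]μ′≡μ unique
           (All.map (λ {t} → classify (proj₂ t)) (hN-homogeneous b (suc e))))
        (cong (_* coeff g μ′) (coeff-hN-[n] b e))
  where
  unique : ∀ ν′ → mulM (suc e ∷ []) ν′ ≡ μ → ν′ ≡ μ′
  unique ν′ e′ = mulM-[x]-injective (suc e) (trans e′ (sym [n]μ′≡μ))
  classify : ∀ ν → weight ν ≡ suc e → ν ≡ suc e ∷ [] ⊎ (∀ ν′ → mulM ν ν′ ≢ μ)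
  classify ν wt with ListP.≡-dec ℕ._≟_ ν (suc e ∷ [])
  ... | yes ν≡[n] = inj₁ ν≡[n]
  ... | no ν≢[n]  = inj₂ (λ ν′ e′ → ν≢[n] (only (subst (ν ⊆_) e′ (⊆-mulMˡ ν ν′)) wt))

coeff-hN*P-≡0 : ∀ b e g μ → (∀ {ν} → ν ⊆ μ → weight ν ≢ suc e) → coeff (hN b (suc e) *P g) μ ≡ 0ℤ
coeff-hN*P-≡0 b e g μ avoid =
  coeff-*P-≡0 {Q = λ _ → ⊤} (hN b (suc e)) g μ
    (λ {ν} {ν′} wt _ e′ → avoid (subst (ν ⊆_) e′ (⊆-mulMˡ ν ν′)) wt)
    (hN-homogeneous b (suc e)) (All.universal _ g)

coeff-hN*P-[] : ∀ b e g → coeff (hN b (suc e) *P g) [] ≡ 0ℤ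
coeff-hN*P-[] b e g = coeff-hN*P-≡0 b e g [] λ { [] () }

coeff-hN*P-[n] : ∀ b e g → coeff (hN b (suc e) *P g) (suc e ∷ []) ≡ + b * coeff g []
coeff-hN*P-[n] b e g = coeff-hN*P-factor b e g [] refl λ { (_ ∷ʳ []) () ; (refl ∷ []) _ → refl }

coeff-hN*P-[x] : ∀ b e g {x} → suc e ≢ x → coeff (hN b (suc e) *P g) (x ∷ []) ≡ 0ℤ
coeff-hN*P-[x] b e g {x} n≢x = coeff-hN*P-≡0 b e g (x ∷ [])
  λ { (_ ∷ʳ []) () ; (refl ∷ []) wt → n≢x (trans (sym wt) (weight-[x] x)) }

coeff-hN*P-[n,y] : ∀ b e g {y} → suc e < y →
  coeff (hN b (suc e) *P g) (suc e ∷ y ∷ []) ≡ + b * coeff g (y ∷ [])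
coeff-hN*P-[n,y] b e g {suc y} n<y = coeff-hN*P-factor b e g (suc y ∷ []) (mulM-[x]-[y] (ℕP.<⇒≤ n<y))
  λ { (_ ∷ʳ _ ∷ʳ []) ()
    ; (refl ∷ _ ∷ʳ []) _ → refl
    ; (_ ∷ʳ refl ∷ []) wt → ⊥-elim (ℕP.<⇒≢ n<y (trans (sym wt) (weight-[x] (suc y))))
    ; (refl ∷ refl ∷ []) wt →
        ⊥-elim (ℕP.m+1+n≢m (suc e) (trans (cong (λ z → suc e + z) (sym (weight-[x] (suc y)))) wt)) }

coeff-hN*P-[x,n] : ∀ b e g {x} → x ≢ 0 → x ≤ suc e →
  coeff (hN b (suc e) *P g) (x ∷ suc e ∷ []) ≡ + b * coeff g (x ∷ [])
coeff-hN*P-[x,n] b e g {x} x≢0 x≤n = coeff-hN*P-factor b e g (x ∷ []) (mulM-[y]-[x] x≤n)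
  λ { (_ ∷ʳ _ ∷ʳ []) ()
    ; (refl ∷ _ ∷ʳ []) wt → cong (_∷ []) (trans (sym (weight-[x] x)) wt)
    ; (_ ∷ʳ refl ∷ []) _ → refl
    ; (refl ∷ refl ∷ []) wt →
        ⊥-elim (x≢0 (ℕP.+-cancelʳ-≡ (suc e) x 0 (trans (cong (λ z → x + z) (sym (weight-[x] (suc e)))) wt))) }

coeff-hN*P-[x,y] : ∀ b e g {x y} → suc e ≢ x → suc e ≢ y → suc e ≢ x + y →
  coeff (hN b (suc e) *P g) (x ∷ y ∷ []) ≡ 0ℤ
coeff-hN*P-[x,y] b e g {x} {y} n≢x n≢y n≢x+y = coeff-hN*P-≡0 b e g (x ∷ y ∷ [])
  λ { (_ ∷ʳ _ ∷ʳ []) ()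
    ; (refl ∷ _ ∷ʳ []) wt → n≢x (trans (sym wt) (weight-[x] x))
    ; (_ ∷ʳ refl ∷ []) wt → n≢y (trans (sym wt) (weight-[x] y))
    ; (refl ∷ refl ∷ []) wt → n≢x+y (trans (sym wt) (cong (λ z → x + z) (weight-[x] y))) }

h-below : ∀ b {k s} → k < s → h b (+ k - + s) ≡ zeroP
h-below b {k} k<s with e , refl ← ℕP.m≤n⇒∃[o]m+o≡n k<s =
  cong (h b) (trans (cong (λ z → + k - z) (ℤP.pos-+ (suc k) e)) (x-[1+x+y]≡-[1+y] (+ k) (+ e)))
  where
  x-[1+x+y]≡-[1+y] : ∀ x y → x - (1ℤ ℤ.+ x ℤ.+ y) ≡ - (1ℤ ℤ.+ y)
  x-[1+x+y]≡-[1+y] = solve-∀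

h-diag : ∀ b s → h b (+ s - + s) ≡ oneP
h-diag b s = trans (cong (h b) (ℤP.+-inverseʳ (+ s))) (hN-zero b)

h-above : ∀ b s n → h b (+ (s + n) - + s) ≡ hN b n
h-above b s n = cong (h b) (trans (cong (λ z → z - + s) (ℤP.pos-+ s n)) (x+y-x≡y (+ s) (+ n)))
  where
  x+y-x≡y : ∀ x y → x ℤ.+ y - x ≡ y
  x+y-x≡y = solve-∀

-- Laplace expansion along the first row

minor : ∀ {n} → (Fin (suc n) → Fin (suc n) → Poly) → Fin (suc n) → Fin n → Fin n → Poly
minor A j r c = A (fsuc r) (punchIn j c)

laplaceTerm : ∀ {n} → (Fin (suc n) → Fin (suc n) → Poly) → Monomial → Fin (suc n) → ℤ
laplaceTerm {n} A μ j = sgnFin j * coeff (A fzero j *P det n (minor A j)) μ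

coeff-det≡∑laplaceTerm : ∀ n A μ → coeff (det (suc n) A) μ ≡ ∑ (laplaceTerm A μ)
coeff-det≡∑laplaceTerm n A μ = trans (coeff-sumP-map-tabulate term id μ)
  (sum-cong-≗ (λ j → coeff-scaleP (sgnFin j) (A fzero j *P det n (minor A j)) μ))
  where
  term : Fin (suc n) → Poly
  term j = scaleP (sgnFin j) (A fzero j *P det n (minor A j))

Small : ℕ → Poly → Set
Small v = AllMonomials (Any (_≤ v))

coeff-Small : ∀ {v f μ} → Small v f → All (v <_) μ → coeff f μ ≡ 0ℤ
coeff-Small {v} small v<μ =
  coeff-≡0 (All.map (λ ≤v ν≡μ → AllP.All¬⇒¬Any (All.map ℕP.<⇒≱ v<μ) (subst (Any (_≤ v)) ν≡μ ≤v))
                    small)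

Small-*Pˡ : ∀ {v} f g → Small v f → Small v (f *P g)
Small-*Pˡ f g small =
  AllMonomials-*P f g (λ {ν} {ν′} ≤v _ → Any-mulMˡ ν ν′ ≤v) small (All.universal (λ _ → tt) g)

Small-*Pʳ : ∀ {v} f g → Small v g → Small v (f *P g)
Small-*Pʳ f g small =
  AllMonomials-*P f g (λ {ν} {ν′} _ ≤v → Any-mulMʳ ν ν′ ≤v) (All.universal (λ _ → tt) f) small

Small-det : ∀ {v} n A → (∀ j → Small v (A fzero j *P det n (minor A j))) → Small v (det (suc n) A)
Small-det n A small-terms =
  AllMonomials-sumP _ (AllP.map⁺ (AllP.tabulate⁺ (λ j → AllMonomials-scaleP (sgnFin j) _ (small-terms j))))

Small-det-row : ∀ {v} n A r → (∀ c → Small v (A r c)) → Small v (det n A)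
Small-det-row (suc n) A fzero    small-row = Small-det n A (λ j → Small-*Pˡ (A fzero j) _ (small-row j))
Small-det-row (suc n) A (fsuc r) small-row =
  Small-det n A (λ j → Small-*Pʳ (A fzero j) _ (Small-det-row n (minor A j) r (λ c → small-row (punchIn j c))))

-- In every Laplace term the rows r₁ and r₂ occupy distinct columns, at most one of them labelled a.
Small-det-two-rows : ∀ {v} n A (κ : Fin n → ℕ) a {r₁ r₂} →
  (∀ {c c′} → κ c ≡ κ c′ → c ≡ c′) → r₁ ≢ r₂ →
  (∀ c → Small v (A r₁ c) ⊎ κ c ≡ a) → (∀ c → Small v (A r₂ c) ⊎ κ c ≡ a) → Small v (det n A)
Small-det-two-rows (suc n) A κ a {fzero}    {fzero}    _ r₁≢r₂ _ _ = ⊥-elim (r₁≢r₂ refl)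
Small-det-two-rows (suc n) A κ a {fzero}    {fsuc r₂}  κ-inj _ row₁ row₂ = Small-det n A term
  where
  term : ∀ j → Small _ (A fzero j *P det n (minor A j))
  term j with row₁ j
  ... | inj₁ small = Small-*Pˡ (A fzero j) _ small
  ... | inj₂ κj≡a  = Small-*Pʳ (A fzero j) _ (Small-det-row n (minor A j) r₂ row)
    where
    row : ∀ c → Small _ (A (fsuc r₂) (punchIn j c))
    row c with row₂ (punchIn j c)
    ... | inj₁ small = small
    ... | inj₂ κc≡a  = ⊥-elim (FinP.punchInᵢ≢i j c (κ-inj (trans κc≡a (sym κj≡a))))
Small-det-two-rows (suc n) A κ a {fsuc r₁} {fzero}    κ-inj r₁≢r₂ row₁ row₂ =
  Small-det-two-rows (suc n) A κ a κ-inj (r₁≢r₂ ∘′ sym) row₂ row₁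
Small-det-two-rows (suc n) A κ a {fsuc r₁} {fsuc r₂}  κ-inj r₁≢r₂ row₁ row₂ =
  Small-det n A (λ j → Small-*Pʳ (A fzero j) _
    (Small-det-two-rows n (minor A j) (κ ∘′ punchIn j) a (FinP.punchIn-injective j _ _ ∘′ κ-inj)
       (r₁≢r₂ ∘′ cong fsuc) (λ c → row₁ (punchIn j c)) (λ c → row₂ (punchIn j c))))

-- φ m D is, definitionally, ±det (hMatrix (proj₂ ∘ D) (∣_∣P ∘ D) toℕ).
hMatrix : ∀ {n} → (Fin n → ℕ) → (Fin n → ℤ) → (Fin n → ℕ) → Fin n → Fin n → Poly
hMatrix b σ κ r c = h (b r) (+ κ c - σ r)

hMatrix-entry : ∀ {n s} b σ κ (r c : Fin n) → σ r ≡ + s → hMatrix b σ κ r c ≡ h (b r) (+ κ c - + s)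
hMatrix-entry b σ κ r c = cong (λ z → h (b r) (+ κ c - z))

<⇒≡+suc : ∀ {m n} → m < n → ∃ λ e → n ≡ m + suc e
<⇒≡+suc {m} m<n with e , refl ← ℕP.m≤n⇒∃[o]m+o≡n m<n = e , sym (ℕP.+-suc m e)

Small-hN : ∀ {v} b n → n ≢ 0 → n ≤ v → Small v (hN b n)
Small-hN {v} b n n≢0 n≤v = All.map (λ {t} → head≤v (proj₂ t)) (hN-homogeneous b n)
  where
  head≤v : ∀ ν → weight ν ≡ n → Any (_≤ v) ν
  head≤v []      wt = ⊥-elim (n≢0 (sym wt))
  head≤v (x ∷ ν) wt = here (ℕP.≤-trans (ℕP.m≤m+n x (weight ν)) (ℕP.≤-trans (ℕP.≤-reflexive wt) n≤v))

hMatrix-entry-small : ∀ {n v a} b σ κ (r c : Fin n) → σ r ≡ + a → κ c ≤ a + v →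
  Small v (hMatrix b σ κ r c) ⊎ κ c ≡ a
hMatrix-entry-small {a = a} b σ κ r c σr≡ κc≤ with ℕP.<-cmp (κ c) a
... | tri< κc<a _ _ =
  inj₁ (subst (Small _) (sym (trans (hMatrix-entry b σ κ r c σr≡) (h-below (b r) κc<a))) [])
... | tri≈ _ κc≡a _ = inj₂ κc≡a
... | tri> _ _ a<κc with e , κc≡ ← <⇒≡+suc a<κc =
  inj₁ (subst (Small _) (sym entry≡hN)
    (Small-hN (b r) (suc e) (λ ()) (ℕP.+-cancelˡ-≤ a _ _ (subst (_≤ a + _) κc≡ κc≤))))
  where
  entry≡hN : hMatrix b σ κ r c ≡ hN (b r) (suc e)
  entry≡hN = trans (hMatrix-entry b σ κ r c σr≡)
                   (trans (cong (λ k → h (b r) (+ k - + a)) κc≡) (h-above (b r) a (suc e)))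

Small-det-hMatrix : ∀ {v} n b σ κ a {r₁ r₂} → r₁ ≢ r₂ → σ r₁ ≡ + a → σ r₂ ≡ + a →
  (∀ {c c′} → κ c ≡ κ c′ → c ≡ c′) → (∀ c → κ c ≤ a + v) → Small v (det n (hMatrix b σ κ))
Small-det-hMatrix n b σ κ a r₁≢r₂ σr₁≡ σr₂≡ κ-inj κ≤ =
  Small-det-two-rows n (hMatrix b σ κ) κ a κ-inj r₁≢r₂
    (λ c → hMatrix-entry-small b σ κ _ c σr₁≡ (κ≤ c))
    (λ c → hMatrix-entry-small b σ κ _ c σr₂≡ (κ≤ c))

module _ {n} (b : Fin (suc n) → ℕ) (σ : Fin (suc n) → ℤ) (κ : Fin (suc n) → ℕ) where

  private
    A : Fin (suc n) → Fin (suc n) → Poly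
    A = hMatrix b σ κ
    G : Fin (suc n) → Poly
    G j = det n (minor A j)
    term-via : ∀ {μ j f} → A fzero j ≡ f → laplaceTerm A μ j ≡ sgnFin j * coeff (f *P G j) μ
    term-via {μ} {j} = cong (λ f → sgnFin j * coeff (f *P G j) μ)

  term-diag : ∀ μ j → σ fzero ≡ + κ j → laplaceTerm A μ j ≡ sgnFin j * coeff (G j) μ
  term-diag μ j σ₀≡ = trans (term-via (trans (hMatrix-entry b σ κ fzero j σ₀≡) (h-diag (b fzero) (κ j))))
                            (cong (sgnFin j *_) (coeff-oneP-*P (G j) μ))

  term-above : ∀ {s e} μ j → σ fzero ≡ + s → κ j ≡ s + suc e →
    laplaceTerm A μ j ≡ sgnFin j * coeff (hN (b fzero) (suc e) *P G j) μ
  term-above {s} {e} μ j σ₀≡ κj≡ = term-via (trans (hMatrix-entry b σ κ fzero j σ₀≡)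
    (trans (cong (λ k → h (b fzero) (+ k - + s)) κj≡) (h-above (b fzero) s (suc e))))

  term-[n] : ∀ {s e} j → σ fzero ≡ + s → κ j ≡ s + suc e →
    laplaceTerm A (suc e ∷ []) j ≡ sgnFin j * (+ b fzero * coeff (G j) [])
  term-[n] j σ₀≡ κj≡ = trans (term-above _ j σ₀≡ κj≡) (cong (sgnFin j *_) (coeff-hN*P-[n] (b fzero) _ (G j)))

  term-[x]≡0 : ∀ {s e x} j → σ fzero ≡ + s → κ j ≡ s + suc e → (suc e ≡ x → coeff (G j) [] ≡ 0ℤ) →
    laplaceTerm A (x ∷ []) j ≡ 0ℤ
  term-[x]≡0 {s} {e} {x} j σ₀≡ κj≡ pivot⇒0 =
    trans (term-above _ j σ₀≡ κj≡) (trans (cong (sgnFin j *_) vanish) (ℤP.*-zeroʳ (sgnFin j)))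
    where
    vanish : coeff (hN (b fzero) (suc e) *P G j) (x ∷ []) ≡ 0ℤ
    vanish with suc e ℕ.≟ x
    ... | yes refl = trans (coeff-hN*P-[n] (b fzero) e (G j))
                           (trans (cong (+ b fzero *_) (pivot⇒0 refl)) (ℤP.*-zeroʳ (+ b fzero)))
    ... | no n≢x   = coeff-hN*P-[x] (b fzero) e (G j) n≢x

  term-[v,w] : ∀ {s v w} j → σ fzero ≡ + s → κ j ≡ s + w → v ≢ 0 → v ≤ w →
    laplaceTerm A (v ∷ w ∷ []) j ≡ sgnFin j * (+ b fzero * coeff (G j) (v ∷ []))
  term-[v,w] {v = zero}         _ _ _ v≢0 _ = ⊥-elim (v≢0 refl)
  term-[v,w] {v = suc _} {zero} _ _ _ _   ()
  term-[v,w] {s} {suc v} {suc e} j σ₀≡ κj≡ v≢0 v≤w =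
    trans (term-above _ j σ₀≡ κj≡) (cong (sgnFin j *_) (coeff-hN*P-[x,n] (b fzero) e (G j) v≢0 v≤w))

  term-[v,w]≡0 : ∀ {s e v w} j → σ fzero ≡ + s → κ j ≡ s + suc e → v ≤ w →
    suc e ≢ w → suc e ≢ v + w → (suc e ≡ v → coeff (G j) (w ∷ []) ≡ 0ℤ) →
    laplaceTerm A (v ∷ w ∷ []) j ≡ 0ℤ
  term-[v,w]≡0 {s} {e} {v} {w} j σ₀≡ κj≡ v≤w n≢w n≢v+w at-v⇒0 =
    trans (term-above _ j σ₀≡ κj≡) (trans (cong (sgnFin j *_) vanish) (ℤP.*-zeroʳ (sgnFin j)))
    where
    vanish : coeff (hN (b fzero) (suc e) *P G j) (v ∷ w ∷ []) ≡ 0ℤ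
    vanish with suc e ℕ.≟ v
    ... | yes refl = trans (coeff-hN*P-[n,y] (b fzero) e (G j) (ℕP.≤∧≢⇒< v≤w n≢w))
                           (trans (cong (+ b fzero *_) (at-v⇒0 refl)) (ℤP.*-zeroʳ (+ b fzero)))
    ... | no n≢v   = coeff-hN*P-[x,y] (b fzero) e (G j) n≢v n≢w n≢v+w

  coeff-det-peel : ∀ μ → σ fzero ≡ + κ fzero → (∀ j → laplaceTerm A μ (fsuc j) ≡ 0ℤ) →
    coeff (det (suc n) A) μ ≡ coeff (det n (minor A fzero)) μ
  coeff-det-peel μ σ₀≡κ₀ others = begin
    coeff (det (suc n) A) μ           ≡⟨ coeff-det≡∑laplaceTerm n A μ ⟩
    ∑ (laplaceTerm A μ)               ≡⟨ ∑-single (laplaceTerm A μ) fzero first-only ⟩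
    laplaceTerm A μ fzero             ≡⟨ term-diag μ fzero σ₀≡κ₀ ⟩
    1ℤ * coeff (G fzero) μ            ≡⟨ ℤP.*-identityˡ _ ⟩
    coeff (det n (minor A fzero)) μ   ∎
    where
    open ≡-Reasoning
    first-only : ∀ j → j ≢ fzero → laplaceTerm A μ j ≡ 0ℤ
    first-only fzero    j≢0 = ⊥-elim (j≢0 refl)
    first-only (fsuc j) _   = others j

  coeff-det-[x]-peel : ∀ {s} x → σ fzero ≡ + s → κ fzero ≡ s → (∀ j → s < κ (fsuc j)) →
    (∀ j → coeff (G (fsuc j)) [] ≡ 0ℤ) →
    coeff (det (suc n) A) (x ∷ []) ≡ coeff (det n (minor A fzero)) (x ∷ [])
  coeff-det-[x]-peel x σ₀≡ κ₀≡ s<κ no-constant =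
    coeff-det-peel (x ∷ []) (trans σ₀≡ (cong +_ (sym κ₀≡))) λ j →
      let e , κj≡ = <⇒≡+suc (s<κ j) in term-[x]≡0 (fsuc j) σ₀≡ κj≡ (λ _ → no-constant j)

toℕ-punchIn-< : ∀ {n} (j : Fin (suc n)) c → toℕ c < toℕ j → toℕ (punchIn j c) ≡ toℕ c
toℕ-punchIn-< (fsuc j) fzero    _   = refl
toℕ-punchIn-< (fsuc j) (fsuc c) c<j = cong suc (toℕ-punchIn-< j c (ℕ.s<s⁻¹ c<j))

toℕ-punchIn-≥ : ∀ {n} (j : Fin (suc n)) c → toℕ j ≤ toℕ c → toℕ (punchIn j c) ≡ suc (toℕ c)
toℕ-punchIn-≥ fzero    c        _   = refl
toℕ-punchIn-≥ (fsuc j) (fsuc c) j≤c = cong suc (toℕ-punchIn-≥ j c (ℕ.s≤s⁻¹ j≤c))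

toℕ-punchIn-fromℕ : ∀ {n} (c : Fin n) → toℕ (punchIn (fromℕ n) c) ≡ toℕ c
toℕ-punchIn-fromℕ {n} c =
  toℕ-punchIn-< (fromℕ n) c (subst (toℕ c <_) (sym (FinP.toℕ-fromℕ n)) (FinP.toℕ<n c))

toℕ-punchIn-fromℕ-≢ : ∀ {n} (c : Fin n) → toℕ (punchIn (fromℕ n) c) ≢ n
toℕ-punchIn-fromℕ-≢ c e = ℕP.<⇒≢ (FinP.toℕ<n c) (trans (sym (toℕ-punchIn-fromℕ c)) e)

parity-suc : ∀ n → parity (suc n) ≡ - parity n
parity-suc zero          = refl
parity-suc (suc zero)    = refl
parity-suc (suc (suc n)) = parity-suc n

sgnFin≡parity : ∀ {n} (j : Fin n) → sgnFin j ≡ parity (toℕ j)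
sgnFin≡parity fzero    = refl
sgnFin≡parity (fsuc j) = trans (cong -_ (sgnFin≡parity j)) (sym (parity-suc (toℕ j)))

sgnFin-fromℕ : ∀ n → sgnFin (fromℕ n) ≡ parity n
sgnFin-fromℕ n = trans (sgnFin≡parity (fromℕ n)) (cong parity (FinP.toℕ-fromℕ n))

coeff-det-unitriangular : ∀ n b σ κ t → (∀ r → σ r ≡ + (t + toℕ r)) → (∀ c → κ c ≡ t + toℕ c) →
  coeff (det n (hMatrix b σ κ)) [] ≡ 1ℤ
coeff-det-unitriangular zero    b σ κ t σ≡ κ≡ = refl
coeff-det-unitriangular (suc n) b σ κ t σ≡ κ≡ = trans
  (coeff-det-peel b σ κ [] (trans (σ≡ fzero) (cong +_ (sym (κ≡ fzero)))) λ j →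
    trans (term-above b σ κ [] (fsuc j) (σ≡ fzero)
             (trans (κ≡ (fsuc j)) (cong (_+ suc (toℕ j)) (sym (ℕP.+-identityʳ t)))))
          (trans (cong (sgnFin (fsuc j) *_) (coeff-hN*P-[] (b fzero) (toℕ j) _)) (ℤP.*-zeroʳ (sgnFin (fsuc j)))))
  (coeff-det-unitriangular n _ _ _ (suc t) (λ r → trans (σ≡ (fsuc r)) (cong +_ (ℕP.+-suc t (toℕ r))))
                                          (λ c → trans (κ≡ (fsuc c)) (ℕP.+-suc t (toℕ c))))

-- Rows σ = s, s+1, …, s+m and columns s+1, …, s+m, s+m+2: only the last column reaches weight m+2.
coeff-det-pivotLast : ∀ m s (b : Fin (suc m) → ℕ) σ κ →
  σ fzero ≡ + s → (∀ r → σ (fsuc r) ≡ + (s + suc (toℕ r))) →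
  (∀ c → toℕ c ≢ m → κ c ≡ s + suc (toℕ c)) → κ (fromℕ m) ≡ s + suc (suc m) →
  coeff (det (suc m) (hMatrix b σ κ)) (suc (suc m) ∷ []) ≡ parity m * (+ b fzero * 1ℤ)
coeff-det-pivotLast m s b σ κ σ₀≡ σ₊≡ κ-stair κ-last = begin
  coeff (det (suc m) A) μ
    ≡⟨ coeff-det≡∑laplaceTerm m A μ ⟩
  ∑ (laplaceTerm A μ)
    ≡⟨ ∑-single _ (fromℕ m) off ⟩
  laplaceTerm A μ (fromℕ m)
    ≡⟨ term-[n] b σ κ (fromℕ m) σ₀≡ κ-last ⟩
  sgnFin (fromℕ m) * (+ b fzero * coeff (det m (minor A (fromℕ m))) [])
    ≡⟨ cong₂ _*_ (sgnFin-fromℕ m) (cong (+ b fzero *_) unitriangular) ⟩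
  parity m * (+ b fzero * 1ℤ)
    ∎
  where
  open ≡-Reasoning
  A : Fin (suc m) → Fin (suc m) → Poly
  A = hMatrix b σ κ
  μ : Monomial
  μ = suc (suc m) ∷ []
  off : ∀ j → j ≢ fromℕ m → laplaceTerm A μ j ≡ 0ℤ
  off j j≢m = term-[x]≡0 b σ κ j σ₀≡
    (κ-stair j (j≢m ∘′ FinP.toℕ-injective ∘′ (λ e → trans e (sym (FinP.toℕ-fromℕ m)))))
    (λ e → ⊥-elim (ℕP.<⇒≢ (FinP.toℕ<n j) (ℕP.suc-injective e)))
  unitriangular : coeff (det m (minor A (fromℕ m))) [] ≡ 1ℤ
  unitriangular = coeff-det-unitriangular m (b ∘′ fsuc) (σ ∘′ fsuc) (κ ∘′ punchIn (fromℕ m)) (suc s)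
    (λ r → trans (σ₊≡ r) (cong +_ (ℕP.+-suc s (toℕ r))))
    (λ c → trans (κ-stair (punchIn (fromℕ m) c) (toℕ-punchIn-fromℕ-≢ c))
                 (trans (cong (λ z → s + suc z) (toℕ-punchIn-fromℕ c)) (ℕP.+-suc s (toℕ c))))

-- Rows σ = s, s, s+1, …, s+m and columns s, s+1, …, s+m, s+m+2: the first and the last column
-- contribute b₁ and b₀ with opposite signs.
coeff-det-pairBlock : ∀ m s (b : Fin (suc (suc m)) → ℕ) σ κ →
  σ fzero ≡ + s → (∀ r → σ (fsuc r) ≡ + (s + toℕ r)) →
  (∀ c → toℕ c ≢ suc m → κ c ≡ s + toℕ c) → (∀ c → toℕ c ≡ suc m → κ c ≡ s + suc (suc m)) →
  coeff (det (suc (suc m)) (hMatrix b σ κ)) (suc (suc m) ∷ []) ≡ parity (suc m) * (+ b fzero - + b (fsuc fzero))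
coeff-det-pairBlock m s b σ κ σ₀≡ σ₊≡ κ-stair κ-top = begin
  coeff (det (suc (suc m)) A) μ                              ≡⟨ coeff-det≡∑laplaceTerm (suc m) A μ ⟩
  ∑ (laplaceTerm A μ)                                        ≡⟨ ∑-two (laplaceTerm A μ) (fromℕ m) off ⟩
  laplaceTerm A μ fzero ℤ.+ laplaceTerm A μ (fsuc (fromℕ m)) ≡⟨ cong₂ ℤ._+_ first last ⟩
  1ℤ * (parity m * (b₁ * 1ℤ)) ℤ.+ (- parity m) * (b₀ * 1ℤ)   ≡⟨ pair-sum (parity m) b₀ b₁ ⟩
  (- parity m) * (b₀ - b₁)                                   ≡⟨ cong (_* (b₀ - b₁)) (parity-suc m) ⟨
  parity (suc m) * (b₀ - b₁)                                 ∎
  where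
  open ≡-Reasoning
  A : Fin (suc (suc m)) → Fin (suc (suc m)) → Poly
  A = hMatrix b σ κ
  μ : Monomial
  μ = suc (suc m) ∷ []
  b₀ b₁ : ℤ
  b₀ = + b fzero
  b₁ = + b (fsuc fzero)
  pair-sum : ∀ p x y → 1ℤ * (p * (y * 1ℤ)) ℤ.+ (- p) * (x * 1ℤ) ≡ (- p) * (x - y)
  pair-sum = solve-∀
  last-column : κ (fsuc (fromℕ m)) ≡ s + suc (suc m)
  last-column = κ-top (fsuc (fromℕ m)) (cong suc (FinP.toℕ-fromℕ m))
  off : ∀ j → j ≢ fzero → j ≢ fsuc (fromℕ m) → laplaceTerm A μ j ≡ 0ℤ
  off fzero    j≢0 _   = ⊥-elim (j≢0 refl)
  off (fsuc j) _   j≢m = term-[x]≡0 b σ κ (fsuc j) σ₀≡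
    (κ-stair (fsuc j) (j≢m ∘′ cong fsuc ∘′ FinP.toℕ-injective
                       ∘′ (λ e → trans (ℕP.suc-injective e) (sym (FinP.toℕ-fromℕ m)))))
    (λ e → ⊥-elim (ℕP.<⇒≢ (FinP.toℕ<n j) (ℕP.suc-injective e)))
  first : laplaceTerm A μ fzero ≡ 1ℤ * (parity m * (b₁ * 1ℤ))
  first = trans (term-diag b σ κ μ fzero (trans σ₀≡ (cong +_ (sym (trans (κ-stair fzero (λ ()))
                                                                       (ℕP.+-identityʳ s))))))
    (cong (1ℤ *_) (coeff-det-pivotLast m s (b ∘′ fsuc) (σ ∘′ fsuc) (κ ∘′ fsuc)
      (trans (σ₊≡ fzero) (cong +_ (ℕP.+-identityʳ s))) (λ r → σ₊≡ (fsuc r))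
      (λ c c≢m → κ-stair (fsuc c) (c≢m ∘′ ℕP.suc-injective)) last-column))
  last : laplaceTerm A μ (fsuc (fromℕ m)) ≡ (- parity m) * (b₀ * 1ℤ)
  last = trans (term-[n] b σ κ (fsuc (fromℕ m)) σ₀≡ last-column)
               (cong₂ _*_ (cong -_ (sgnFin-fromℕ m)) (cong (b₀ *_) unitriangular))
    where
    unitriangular : coeff (det (suc m) (minor A (fsuc (fromℕ m)))) [] ≡ 1ℤ
    unitriangular =
      coeff-det-unitriangular (suc m) (b ∘′ fsuc) (σ ∘′ fsuc) (κ ∘′ punchIn (fromℕ (suc m))) s σ₊≡
      (λ c → trans (κ-stair _ (toℕ-punchIn-fromℕ-≢ c)) (cong (λ z → s + z) (toℕ-punchIn-fromℕ c)))

-- Rows σ = s, s+1, …, s+d, s+d, s+d+1, … and columns s, s+1, …, s+d+m, s+d+m+2. The staircase rows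
-- above the repeated pair are peeled off one by one: the other minors of the first row still contain
-- the pair, hence have no constant term.
coeff-det-chain : ∀ m d s (b : Fin (suc (d + suc m)) → ℕ) σ κ {r₁ r₂} →
  (∀ r → toℕ r ≤ d → σ r ≡ + (s + toℕ r)) →
  (∀ r t → toℕ r ≡ suc (d + t) → σ r ≡ + (s + d + t)) →
  (∀ c → toℕ c ≢ d + suc m → κ c ≡ s + toℕ c) →
  (∀ c → toℕ c ≡ d + suc m → κ c ≡ s + d + suc (suc m)) →
  (∀ {c c′} → κ c ≡ κ c′ → c ≡ c′) → (∀ c → κ c ≤ s + d + suc (suc m)) →
  toℕ r₁ ≡ d → toℕ r₂ ≡ suc d →
  coeff (det (suc (d + suc m)) (hMatrix b σ κ)) (suc (suc m) ∷ []) ≡ parity (suc m) * (+ b r₁ - + b r₂)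
coeff-det-chain m zero s b σ κ {fzero} {fsuc fzero} σ-stair σ-pair κ-stair κ-top _ _ _ _ =
  coeff-det-pairBlock m s b σ κ
    (trans (σ-stair fzero z≤n) (cong +_ (ℕP.+-identityʳ s)))
    (λ r → trans (σ-pair (fsuc r) (toℕ r) refl) (cong (λ z → + (z + toℕ r)) (ℕP.+-identityʳ s)))
    κ-stair
    (λ c e → trans (κ-top c e) (cong (_+ suc (suc m)) (ℕP.+-identityʳ s)))
coeff-det-chain m (suc d) s b σ κ {fsuc r₁} {fsuc r₂} σ-stair σ-pair κ-stair κ-top κ-inj κ≤ r₁≡ r₂≡ =
  trans (coeff-det-[x]-peel b σ κ v (trans (σ-stair fzero z≤n) (cong +_ (ℕP.+-identityʳ s)))
                            (trans (κ-stair fzero (λ ())) (ℕP.+-identityʳ s)) s<κ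
                            (λ j → coeff-Small (small-minor j) []))
        (coeff-det-chain m d (suc s) (b ∘′ fsuc) (σ ∘′ fsuc) (κ ∘′ fsuc)
          (λ r r≤d → trans (σ-stair (fsuc r) (s≤s r≤d)) (cong +_ (ℕP.+-suc s (toℕ r))))
          (λ r t e → trans (σ-pair (fsuc r) t (cong suc e)) (cong (λ z → + (z + t)) s+1+d≡))
          (λ c ne → trans (κ-stair (fsuc c) (ne ∘′ ℕP.suc-injective)) (ℕP.+-suc s (toℕ c)))
          (λ c e → trans (κ-top (fsuc c) (cong suc e)) (cong (_+ v) s+1+d≡))
          (FinP.suc-injective ∘′ κ-inj) (λ c → subst (κ (fsuc c) ≤_) (cong (_+ v) s+1+d≡) (κ≤ (fsuc c)))
          (ℕP.suc-injective r₁≡) (ℕP.suc-injective r₂≡))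
  where
  v : ℕ
  v = suc (suc m)
  A : Fin (suc (suc d + suc m)) → Fin (suc (suc d + suc m)) → Poly
  A = hMatrix b σ κ
  s+1+d≡ : s + suc d ≡ suc s + d
  s+1+d≡ = ℕP.+-suc s d
  s<κ : ∀ j → s < κ (fsuc j)
  s<κ j with toℕ (fsuc j) ℕ.≟ suc d + suc m
  ... | yes top = subst (s <_) (sym (κ-top (fsuc j) top))
                        (ℕP.<-≤-trans (ℕP.m<m+n s (s≤s z≤n)) (ℕP.m≤m+n (s + suc d) v))
  ... | no ¬top = subst (s <_) (sym (κ-stair (fsuc j) ¬top)) (ℕP.m<m+n s (s≤s z≤n))
  small-minor : ∀ j → Small v (det (suc (d + suc m)) (minor A (fsuc j)))
  small-minor j =
    Small-det-hMatrix (suc (d + suc m)) (b ∘′ fsuc) (σ ∘′ fsuc) (κ ∘′ punchIn (fsuc j)) (s + suc d) {r₁} {r₂}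
      (λ r₁≡r₂ → ℕP.<⇒≢ (ℕP.n<1+n (suc d)) (trans (sym r₁≡) (trans (cong (toℕ ∘′ fsuc) r₁≡r₂) r₂≡)))
      (trans (σ-stair (fsuc r₁) (ℕP.≤-reflexive r₁≡)) (cong (λ z → + (s + z)) r₁≡))
      (trans (σ-pair (fsuc r₂) 0 (trans r₂≡ (cong suc (sym (ℕP.+-identityʳ (suc d))))))
             (cong +_ (ℕP.+-identityʳ _)))
      (FinP.punchIn-injective (fsuc j) _ _ ∘′ κ-inj) (λ c → κ≤ (punchIn (fsuc j) c))

-- Rows 0 and 1 both have σ = 0 and the columns are 0, …, w+1. Along row 0 only the columns 0 and w
-- survive; row 1 then contributes the other of b₀, b₁, and both paths reach the same lower block.
module _ {v w₁ a : ℕ} (b : Fin (suc (suc (suc w₁))) → ℕ) (σ : Fin (suc (suc (suc w₁))) → ℤ)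
         (2≤v : 2 ≤ v) (v≤w : v ≤ suc w₁) (σ₀≡ : σ fzero ≡ + 0) (σ₁≡ : σ (fsuc fzero) ≡ + 0)
         {r₁ r₂ : Fin (suc w₁)} (r₁≢r₂ : r₁ ≢ r₂)
         (σr₁≡ : σ (fsuc (fsuc r₁)) ≡ + a) (σr₂≡ : σ (fsuc (fsuc r₂)) ≡ + a)
         (a+v≡ : a + v ≡ suc (suc w₁)) (ℓ : Fin (suc (suc w₁))) (ℓ≡ : toℕ ℓ ≡ w₁) (X : ℤ)
         (lower≡X : coeff (det (suc w₁) (hMatrix (b ∘′ fsuc ∘′ fsuc) (σ ∘′ fsuc ∘′ fsuc)
                                                 (λ c → suc (toℕ (punchIn ℓ c)))))
                          (v ∷ []) ≡ X) where

  private
    w : ℕ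
    w = suc w₁
    A : Fin (suc (suc w)) → Fin (suc (suc w)) → Poly
    A = hMatrix b σ toℕ
    μ : Monomial
    μ = v ∷ w ∷ []
    toℕ≤ : (c : Fin (suc (suc w))) → toℕ c ≤ suc w
    toℕ≤ c = ℕ.s≤s⁻¹ (FinP.toℕ<n c)
    punchIn-inj : ∀ {n} {κ : Fin (suc n) → ℕ} (j : Fin (suc n)) →
      (∀ {c c′} → κ c ≡ κ c′ → c ≡ c′) → ∀ {c c′} → κ (punchIn j c) ≡ κ (punchIn j c′) → c ≡ c′
    punchIn-inj j κ-inj = FinP.punchIn-injective j _ _ ∘′ κ-inj
    small-rows≥2 : ∀ κ → (∀ {c c′} → κ c ≡ κ c′ → c ≡ c′) → (∀ c → κ c ≤ suc w) →
      Small v (det w (hMatrix (b ∘′ fsuc ∘′ fsuc) (σ ∘′ fsuc ∘′ fsuc) κ))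
    small-rows≥2 κ κ-inj κ≤ =
      Small-det-hMatrix w (b ∘′ fsuc ∘′ fsuc) (σ ∘′ fsuc ∘′ fsuc) κ a r₁≢r₂ σr₁≡ σr₂≡ κ-inj
      (λ c → subst (κ c ≤_) (sym a+v≡) (κ≤ c))
    small-rows≥1 : ∀ κ → (∀ {c c′} → κ c ≡ κ c′ → c ≡ c′) → (∀ c → κ c ≤ suc w) →
      Small v (det (suc w) (hMatrix (b ∘′ fsuc) (σ ∘′ fsuc) κ))
    small-rows≥1 κ κ-inj κ≤ =
      Small-det-hMatrix (suc w) (b ∘′ fsuc) (σ ∘′ fsuc) κ a (r₁≢r₂ ∘′ FinP.suc-injective) σr₁≡ σr₂≡ κ-inj
      (λ c → subst (κ c ≤_) (sym a+v≡) (κ≤ c))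
    v≢0 : v ≢ 0
    v≢0 v≡0 with () ← subst (2 ≤_) v≡0 2≤v
    ≢v+w : ∀ k → k ≤ suc w → k ≢ v + w
    ≢v+w k k≤ k≡ = ℕP.<⇒≱ (ℕP.+-monoˡ-< w 2≤v) (subst (_≤ suc w) k≡ k≤)
    ≢w : ∀ (j : Fin (suc w)) → j ≢ ℓ → suc (toℕ j) ≢ w
    ≢w j j≢ℓ e = j≢ℓ (FinP.toℕ-injective (trans (ℕP.suc-injective e) (sym ℓ≡)))
    v<w : ∀ {k} → k ≢ w → k ≡ v → v < w
    v<w k≢w refl = ℕP.≤∧≢⇒< v≤w k≢w

  coeff-det-minor₀-[v,w] :
    coeff (det (suc w) (minor (hMatrix b σ toℕ) fzero)) (v ∷ w ∷ []) ≡ sgnFin ℓ * (+ b (fsuc fzero) * X)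
  coeff-det-minor₀-[v,w] = begin
    coeff (det (suc w) (minor A fzero)) μ
      ≡⟨ coeff-det≡∑laplaceTerm w (minor A fzero) μ ⟩
    ∑ (laplaceTerm (minor A fzero) μ)
      ≡⟨ ∑-single _ ℓ off ⟩
    laplaceTerm (minor A fzero) μ ℓ
      ≡⟨ term-[v,w] (b ∘′ fsuc) (σ ∘′ fsuc) (toℕ ∘′ fsuc) ℓ σ₁≡ (cong suc ℓ≡) v≢0 v≤w ⟩
    sgnFin ℓ * (+ b (fsuc fzero) * coeff (det w (minor (minor A fzero) ℓ)) (v ∷ []))
      ≡⟨ cong (λ z → sgnFin ℓ * (+ b (fsuc fzero) * z)) lower≡X ⟩
    sgnFin ℓ * (+ b (fsuc fzero) * X)
      ∎
    where
    open ≡-Reasoning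
    off : ∀ j → j ≢ ℓ → laplaceTerm (minor A fzero) μ j ≡ 0ℤ
    off j j≢ℓ =
      term-[v,w]≡0 (b ∘′ fsuc) (σ ∘′ fsuc) (toℕ ∘′ fsuc) j σ₁≡ refl v≤w (≢w j j≢ℓ) (≢v+w _ (toℕ≤ (fsuc j)))
        (λ e → coeff-Small (small-rows≥2 (toℕ ∘′ fsuc ∘′ punchIn j)
                                         (punchIn-inj j (punchIn-inj fzero FinP.toℕ-injective))
                                         (λ c → toℕ≤ (fsuc (punchIn j c))))
                           (v<w (≢w j j≢ℓ) e ∷ []))

  coeff-det-minorℓ-[v] : coeff (det (suc w) (minor (hMatrix b σ toℕ) (fsuc ℓ))) (v ∷ []) ≡ X
  coeff-det-minorℓ-[v] = trans
    (coeff-det-[x]-peel (b ∘′ fsuc) (σ ∘′ fsuc) (toℕ ∘′ punchIn (fsuc ℓ)) v σ₁≡ refl (λ _ → s≤s z≤n)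
      (λ j → coeff-Small (small-rows≥2 (toℕ ∘′ punchIn (fsuc ℓ) ∘′ punchIn (fsuc j))
                                       (punchIn-inj (fsuc j) (punchIn-inj (fsuc ℓ) FinP.toℕ-injective))
                                       (λ c → toℕ≤ (punchIn (fsuc ℓ) (punchIn (fsuc j) c)))) []))
    lower≡X

  coeff-det-top :
    coeff (det (suc (suc w)) (hMatrix b σ toℕ)) (v ∷ w ∷ []) ≡ parity w * ((+ b fzero - + b (fsuc fzero)) * X)
  coeff-det-top = begin
    coeff (det (suc (suc w)) A) μ
      ≡⟨ coeff-det≡∑laplaceTerm (suc w) A μ ⟩
    ∑ (laplaceTerm A μ)
      ≡⟨ ∑-two (laplaceTerm A μ) ℓ off ⟩
    laplaceTerm A μ fzero ℤ.+ laplaceTerm A μ (fsuc ℓ)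
      ≡⟨ cong₂ ℤ._+_ first last ⟩
    1ℤ * (P * (b₁ * X)) ℤ.+ (- P) * (b₀ * X)
      ≡⟨ top-sum P b₀ b₁ X ⟩
    (- P) * ((b₀ - b₁) * X)
      ≡⟨ cong (λ z → - z * ((b₀ - b₁) * X)) (trans (sgnFin≡parity ℓ) (cong parity ℓ≡)) ⟩
    (- parity w₁) * ((b₀ - b₁) * X)
      ≡⟨ cong (_* ((b₀ - b₁) * X)) (parity-suc w₁) ⟨
    parity w * ((b₀ - b₁) * X)
      ∎
    where
    open ≡-Reasoning
    P b₀ b₁ : ℤ
    P = sgnFin ℓ
    b₀ = + b fzero
    b₁ = + b (fsuc fzero)
    top-sum : ∀ p x y z → 1ℤ * (p * (y * z)) ℤ.+ (- p) * (x * z) ≡ (- p) * ((x - y) * z)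
    top-sum = solve-∀
    off : ∀ j → j ≢ fzero → j ≢ fsuc ℓ → laplaceTerm A μ j ≡ 0ℤ
    off fzero    j≢0 _   = ⊥-elim (j≢0 refl)
    off (fsuc j) _   j≢ℓ =
      term-[v,w]≡0 b σ toℕ (fsuc j) σ₀≡ refl v≤w (≢w j (j≢ℓ ∘′ cong fsuc)) (≢v+w _ (toℕ≤ (fsuc j)))
        (λ e → coeff-Small (small-rows≥1 (toℕ ∘′ punchIn (fsuc j)) (punchIn-inj (fsuc j) FinP.toℕ-injective)
                                         (λ c → toℕ≤ (punchIn (fsuc j) c)))
                           (v<w (≢w j (j≢ℓ ∘′ cong fsuc)) e ∷ []))
    first : laplaceTerm A μ fzero ≡ 1ℤ * (P * (b₁ * X))
    first = trans (term-diag b σ toℕ μ fzero σ₀≡) (cong (1ℤ *_) coeff-det-minor₀-[v,w])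
    last : laplaceTerm A μ (fsuc ℓ) ≡ (- P) * (b₀ * X)
    last = trans (term-[v,w] b σ toℕ (fsuc ℓ) σ₀≡ (cong suc ℓ≡) v≢0 v≤w)
                 (cong (λ z → (- P) * (b₀ * z)) coeff-det-minorℓ-[v])

-- The sign (−1)^k

sumℤ-allFin : ∀ {n} (f : Fin n → ℤ) → sumℤ (map f (allFin n)) ≡ ∑ f
sumℤ-allFin {n} f = trans (cong sumℤ (ListP.map-tabulate id f)) (sumℤ-tabulate f)
  where
  sumℤ-tabulate : ∀ {n} (f : Fin n → ℤ) → sumℤ (tabulate f) ≡ ∑ f
  sumℤ-tabulate {zero}  f = refl
  sumℤ-tabulate {suc n} f = cong (λ z → f fzero ℤ.+ z) (sumℤ-tabulate (λ j → f (fsuc j)))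

suc[n]C2 : ∀ n → suc n C 2 ≡ n C 2 + n
suc[n]C2 n = trans (sym (nCk+nC[k+1]≡[n+1]C[k+1] n 1))
                   (trans (cong (_+ n C 2) (nC1≡n n)) (ℕP.+-comm n (n C 2)))

∑-toℕ : ∀ n → ∑ (λ (i : Fin n) → + toℕ i) ≡ + (n C 2)
∑-toℕ zero    = refl
∑-toℕ (suc n) = begin
  ∑ (λ (i : Fin (suc n)) → + toℕ i)
    ≡⟨ sum-init-last (λ (i : Fin (suc n)) → + toℕ i) ⟩
  ∑ (λ (i : Fin n) → + toℕ (inject₁ i)) ℤ.+ + toℕ (fromℕ n)
    ≡⟨ cong₂ ℤ._+_ (sum-cong-≗ {n} {x = λ i → + toℕ (inject₁ i)} (λ i → cong +_ (FinP.toℕ-inject₁ i)))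
                   (cong +_ (FinP.toℕ-fromℕ n)) ⟩
  ∑ (λ (i : Fin n) → + toℕ i) ℤ.+ + n
    ≡⟨ cong (ℤ._+ + n) (∑-toℕ n) ⟩
  + (n C 2 + n)
    ≡⟨ cong +_ (suc[n]C2 n) ⟨
  + (suc n C 2)
    ∎
  where open ≡-Reasoning

kOf≡∑defect : ∀ n (D : Fin n → Point) (δ : ℕ → ℕ) → (∀ i → ∣ D i ∣P ℤ.+ + δ (toℕ i) ≡ + toℕ i) →
  kOf n D ≡ ∑ (λ (i : Fin n) → + δ (toℕ i))
kOf≡∑defect n D δ size+δ≡index = begin
  + (n C 2) - sumℤ (map size (allFin n))
    ≡⟨ cong₂ _-_ (sym (∑-toℕ n)) (sumℤ-allFin size) ⟩
  ∑ index - ∑ size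
    ≡⟨ cong (_- ∑ size) (sum-cong-≗ {y = λ i → size i ℤ.+ Δ i} (λ i → sym (size+δ≡index i))) ⟩
  ∑ (λ i → size i ℤ.+ Δ i) - ∑ size
    ≡⟨ cong (_- ∑ size) (∑-distrib-+ size Δ) ⟩
  ∑ size ℤ.+ ∑ Δ - ∑ size
    ≡⟨ x+y-x≡y (∑ size) (∑ Δ) ⟩
  ∑ Δ
    ∎
  where
  open ≡-Reasoning
  index size Δ : Fin n → ℤ
  index i = + toℕ i
  size i = ∣ D i ∣P
  Δ i = + δ (toℕ i)
  x+y-x≡y : ∀ x y → x ℤ.+ y - x ≡ y
  x+y-x≡y = solve-∀

onesThenTwos : ℕ → ℕ → ℕ
onesThenTwos zero    _       = 2
onesThenTwos (suc p) zero    = 1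
onesThenTwos (suc p) (suc t) = onesThenTwos p t

onesThenTwos-< : ∀ {p t} → t < p → onesThenTwos p t ≡ 1
onesThenTwos-< {suc p} {zero}  _   = refl
onesThenTwos-< {suc p} {suc t} t<p = onesThenTwos-< (ℕ.s<s⁻¹ t<p)

onesThenTwos-≥ : ∀ {p t} → p ≤ t → onesThenTwos p t ≡ 2
onesThenTwos-≥ {zero}  {t}     _   = refl
onesThenTwos-≥ {suc p} {suc t} p≤t = onesThenTwos-≥ (ℕ.s≤s⁻¹ p≤t)

∑-onesThenTwos : ∀ p n → p ≤ n → ∑ (λ (i : Fin n) → + onesThenTwos p (toℕ i)) ≡ + (n + (n ∸ p))
∑-onesThenTwos zero    zero    _         = refl
∑-onesThenTwos zero    (suc n) _         =
  trans (cong (λ z → + 2 ℤ.+ z) (∑-onesThenTwos zero n z≤n)) (cong (λ z → + suc z) (sym (ℕP.+-suc n n)))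
∑-onesThenTwos (suc p) (suc n) (s≤s p≤n) = cong (λ z → 1ℤ ℤ.+ z) (∑-onesThenTwos p n p≤n)

parity-+ : ∀ m n → parity (m + n) ≡ parity m * parity n
parity-+ zero          n = sym (ℤP.*-identityˡ _)
parity-+ (suc zero)    n = trans (parity-suc n) (sym (ℤP.-1*i≡-i (parity n)))
parity-+ (suc (suc m)) n = parity-+ m n

parity²≡1 : ∀ n → parity n * parity n ≡ 1ℤ
parity²≡1 zero          = refl
parity²≡1 (suc zero)    = refl
parity²≡1 (suc (suc n)) = parity²≡1 n

yAt-suc-toℕ : ∀ {n} (D : Fin n → Point) i → yAt D (suc (toℕ i)) ≡ ∣ D i ∣y
yAt-suc-toℕ {suc n}       D fzero    = refl
yAt-suc-toℕ {suc (suc n)} D (fsuc i) = yAt-suc-toℕ (λ k → D (fsuc k)) i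

distinct⇒y-distinct : ∀ {P Q : Point} → P ≢ Q → ∣ P ∣P ≡ ∣ Q ∣P → proj₂ P ≢ proj₂ Q
distinct⇒y-distinct {a , y} {a′ , .y} P≢Q |P|≡|Q| refl =
  P≢Q (cong (_, y) (trans (sym (x+y-y≡x a (+ y))) (trans (cong (_- + y) |P|≡|Q|) (x+y-y≡x a′ (+ y)))))
  where
  x+y-y≡x : ∀ x y → x ℤ.+ y - y ≡ x
  x+y-y≡x = solve-∀

difference-product≢0 : ∀ {x₀ x₁ y₀ y₁ : ℕ} → x₀ ≢ x₁ → y₀ ≢ y₁ → - ((+ x₀ - + x₁) * (+ y₀ - + y₁)) ≢ 0ℤ
difference-product≢0 {x₀} {x₁} {y₀} {y₁} x₀≢x₁ y₀≢y₁ e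
  with ℤP.i*j≡0⇒i≡0∨j≡0 (+ x₀ - + x₁) (ℤP.neg-injective {j = 0ℤ} e)
... | inj₁ x≡ = x₀≢x₁ (ℤP.+-injective (ℤP.i-j≡0⇒i≡j (+ x₀) (+ x₁) x≡))
... | inj₂ y≡ = y₀≢y₁ (ℤP.+-injective (ℤP.i-j≡0⇒i≡j (+ y₀) (+ y₁) y≡))

above-[v,w]⇒All-v< : ∀ {v w} μ → IsMonomial μ → weight μ ≡ v + w → (v ∷ w ∷ []) <M μ → All (v <_) μ
above-[v,w]⇒All-v< (x ∷ xs)         (_ , sorted) _  (here v<x)         = Linked⇒All ℕP.≤-trans v<x sorted
above-[v,w]⇒All-v< {v} (v ∷ y ∷ ys) _            wt (there (here w<y)) =
  ⊥-elim (ℕP.<⇒≱ w<y (ℕP.≤-trans (ℕP.m≤m+n y (weight ys)) (ℕP.≤-reflexive (ℕP.+-cancelˡ-≡ v _ _ wt))))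

-- Here v = m + 2 and w = d + m + 1, so that the sizes |P_i| are 0, 0, 1, 2, …, d + 1, d + 1, d + 2, …, w − 1.
module _ (m d : ℕ) (D : Fin (suc (suc (suc (d + suc m)))) → Point) (distinct : ∀ i j → i ≢ j → D i ≢ D j)
         (size-low : ∀ i → toℕ i ≤ 1 → ∣ D i ∣P ≡ + 0)
         (size-stair : ∀ i t → toℕ i ≡ suc (suc t) → t ≤ d → ∣ D i ∣P ≡ + suc t)
         (size-pair : ∀ i t → toℕ i ≡ suc (suc (suc (d + t))) → ∣ D i ∣P ≡ + suc (d + t)) where

  private
    v w : ℕ
    v = suc (suc m)
    w = suc (d + suc m)
    b : Fin (suc (suc w)) → ℕ
    b i = proj₂ (D i)
    σ : Fin (suc (suc w)) → ℤ
    σ i = ∣ D i ∣P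
    1+d<w : suc d < w
    1+d<w = s≤s (subst (_≤ d + suc m) (ℕP.+-comm d 1) (ℕP.+-monoʳ-≤ d (s≤s z≤n)))
    r₁ r₂ : Fin w
    r₁ = fromℕ< {d} (s≤s (ℕP.m≤m+n d (suc m)))
    r₂ = fromℕ< 1+d<w
    r₁≡ : toℕ r₁ ≡ d
    r₁≡ = FinP.toℕ-fromℕ< _
    r₂≡ : toℕ r₂ ≡ suc d
    r₂≡ = FinP.toℕ-fromℕ< 1+d<w
    r₁≢r₂ : r₁ ≢ r₂
    r₁≢r₂ e = ℕP.<⇒≢ (ℕP.n<1+n d) (trans (sym r₁≡) (trans (cong toℕ e) r₂≡))
    ℓ : Fin (suc w)
    ℓ = inject₁ (fromℕ (d + suc m))
    ℓ≡ : toℕ ℓ ≡ d + suc m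
    ℓ≡ = trans (FinP.toℕ-inject₁ _) (FinP.toℕ-fromℕ _)
    σr₁≡ : σ (fsuc (fsuc r₁)) ≡ + suc d
    σr₁≡ = size-stair _ d (cong (suc ∘′ suc) r₁≡) ℕP.≤-refl
    σr₂≡ : σ (fsuc (fsuc r₂)) ≡ + suc d
    σr₂≡ = trans (size-pair _ 0 (cong (suc ∘′ suc) (trans r₂≡ (cong suc (sym (ℕP.+-identityʳ d))))))
                 (cong (+_ ∘′ suc) (ℕP.+-identityʳ d))
    κR : Fin w → ℕ
    κR c = suc (toℕ (punchIn ℓ c))
    X : ℤ
    X = parity (suc m) * (+ b (fsuc (fsuc r₁)) - + b (fsuc (fsuc r₂)))
    a+v≡ : suc d + v ≡ suc w
    a+v≡ = cong suc (ℕP.+-suc d (suc m))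
    p₁≢p₂ : fsuc (fsuc r₁) ≢ fsuc (fsuc r₂)
    p₁≢p₂ = r₁≢r₂ ∘′ FinP.suc-injective ∘′ FinP.suc-injective
    y-values : (yAt D 1 - yAt D 2) * (yAt D (d + 3) - yAt D (d + 4))
             ≡ (+ b fzero - + b (fsuc fzero)) * (+ b (fsuc (fsuc r₁)) - + b (fsuc (fsuc r₂)))
    y-values = cong₂ (λ x y → (yAt D 1 - yAt D 2) * (x - y))
      (trans (cong (yAt D) (ℕP.+-comm d 3)) (y-at r₁≡)) (trans (cong (yAt D) (ℕP.+-comm d 4)) (y-at r₂≡))
      where
      y-at : ∀ {r t} → toℕ r ≡ t → yAt D (3 + t) ≡ + b (fsuc (fsuc r))
      y-at {r} refl = yAt-suc-toℕ D (fsuc (fsuc r))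
    -- defect t = t − |P_{t+1}|, so that k = ∑ defect
    defect : ℕ → ℕ
    defect zero    = 0
    defect (suc t) = onesThenTwos (suc (suc d)) t

  coeff-det-lowerBlock : coeff (det w (hMatrix (b ∘′ fsuc ∘′ fsuc) (σ ∘′ fsuc ∘′ fsuc) κR)) (v ∷ []) ≡ X
  coeff-det-lowerBlock = coeff-det-chain m d 1 (b ∘′ fsuc ∘′ fsuc) (σ ∘′ fsuc ∘′ fsuc) κR
    (λ r r≤d → size-stair _ (toℕ r) refl r≤d)
    (λ r t e → size-pair _ t (cong (suc ∘′ suc) e))
    (λ c c≢ → cong suc (toℕ-punchIn-< ℓ c (subst (toℕ c <_) (sym ℓ≡) (ℕP.≤∧≢⇒< (ℕ.s≤s⁻¹ (FinP.toℕ<n c)) c≢))))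
    (λ c c≡ → cong suc (trans (toℕ-punchIn-≥ ℓ c (ℕP.≤-reflexive (trans ℓ≡ (sym c≡))))
                              (trans (cong suc c≡) (sym (ℕP.+-suc d (suc m))))))
    (λ e → FinP.punchIn-injective ℓ _ _ (FinP.toℕ-injective (ℕP.suc-injective e)))
    (λ c → subst (κR c ≤_) (cong suc (sym (ℕP.+-suc d (suc m)))) (FinP.toℕ<n (punchIn ℓ c)))
    r₁≡ r₂≡

  coeff-det-hMatrix-[v,w] :
    coeff (det (suc (suc w)) (hMatrix b σ toℕ)) (v ∷ w ∷ []) ≡ parity w * ((+ b fzero - + b (fsuc fzero)) * X)
  coeff-det-hMatrix-[v,w] =
    coeff-det-top b σ (s≤s (s≤s z≤n)) (s≤s (ℕP.m≤n+m (suc m) d))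
      (size-low fzero z≤n) (size-low (fsuc fzero) (s≤s z≤n)) r₁≢r₂ σr₁≡ σr₂≡ a+v≡ ℓ ℓ≡ X coeff-det-lowerBlock

  size+defect≡index : ∀ i → ∣ D i ∣P ℤ.+ + defect (toℕ i) ≡ + toℕ i
  size+defect≡index fzero           = cong (ℤ._+ 0ℤ) (size-low fzero z≤n)
  size+defect≡index (fsuc fzero)    = cong (ℤ._+ 1ℤ) (size-low (fsuc fzero) (s≤s z≤n))
  size+defect≡index (fsuc (fsuc j)) with ℕP.≤-<-connex (toℕ j) d
  ... | inj₁ j≤d = begin
    ∣ D (fsuc (fsuc j)) ∣P ℤ.+ + onesThenTwos (suc d) (toℕ j)
      ≡⟨ cong₂ ℤ._+_ (size-stair _ (toℕ j) refl j≤d) (cong +_ (onesThenTwos-< (s≤s j≤d))) ⟩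
    + (suc (toℕ j) + 1)
      ≡⟨ cong +_ (ℕP.+-comm (suc (toℕ j)) 1) ⟩
    + suc (suc (toℕ j))
      ∎
    where open ≡-Reasoning
  ... | inj₂ d<j with e , 1+d+e≡j ← ℕP.m≤n⇒∃[o]m+o≡n d<j = begin
    ∣ D (fsuc (fsuc j)) ∣P ℤ.+ + onesThenTwos (suc d) (toℕ j)
      ≡⟨ cong₂ ℤ._+_ (size-pair _ e (cong (suc ∘′ suc) (sym 1+d+e≡j))) (cong +_ (onesThenTwos-≥ d<j)) ⟩
    + (suc (d + e) + 2)
      ≡⟨ cong +_ (ℕP.+-comm (suc (d + e)) 2) ⟩
    + suc (suc (suc (d + e)))
      ≡⟨ cong (+_ ∘′ suc ∘′ suc) 1+d+e≡j ⟩
    + suc (suc (toℕ j))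
      ∎
    where open ≡-Reasoning

  kOf≡v+w : kOf (suc (suc w)) D ≡ + (v + w)
  kOf≡v+w = begin
    kOf (suc (suc w)) D
      ≡⟨ kOf≡∑defect (suc (suc w)) D defect size+defect≡index ⟩
    0ℤ ℤ.+ ∑ (λ (i : Fin (suc w)) → + onesThenTwos (suc (suc d)) (toℕ i))
      ≡⟨ cong (λ z → 0ℤ ℤ.+ z) (∑-onesThenTwos (suc (suc d)) (suc w) (s≤s (s≤s (ℕP.m≤m+n d (suc m))))) ⟩
    + (suc w + (d + suc m ∸ d))
      ≡⟨ cong (λ z → + (suc w + z)) (ℕP.m+n∸m≡n d (suc m)) ⟩
    + (suc w + suc m)
      ≡⟨ cong +_ (trans (ℕP.+-suc (suc w) m) (cong (suc ∘′ suc) (ℕP.+-comm w m))) ⟩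
    + (v + w)
      ∎
    where open ≡-Reasoning

  φ-leadingTerm :
    (coeff (φ (suc (suc w)) D) (v ∷ w ∷ []) ≡ - ((yAt D 1 - yAt D 2) * (yAt D (d + 3) - yAt D (d + 4))))
    × (- ((yAt D 1 - yAt D 2) * (yAt D (d + 3) - yAt D (d + 4))) ≢ 0ℤ)
    × (∀ μ → IsMonomial μ → weight μ ≡ v + w → (v ∷ w ∷ []) <M μ → coeff (φ (suc (suc w)) D) μ ≡ 0ℤ)
  φ-leadingTerm rewrite y-values = leading , nonzero , above-vanishes
    where
    open ≡-Reasoning
    A : Fin (suc (suc w)) → Fin (suc (suc w)) → Poly
    A = hMatrix b σ toℕ
    B Y : ℤ
    B = + b fzero - + b (fsuc fzero)
    Y = + b (fsuc (fsuc r₁)) - + b (fsuc (fsuc r₂))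
    signs : ∀ p q x y → (p * q) * (q * (x * ((- p) * y))) ≡ - ((p * p) * ((q * q) * (x * y)))
    signs = solve-∀
    leading : coeff (φ (suc (suc w)) D) (v ∷ w ∷ []) ≡ - (B * Y)
    leading = begin
      coeff (φ (suc (suc w)) D) (v ∷ w ∷ [])
        ≡⟨ coeff-scaleP (signPow (kOf _ D)) (det _ A) _ ⟩
      signPow (kOf _ D) * coeff (det _ A) (v ∷ w ∷ [])
        ≡⟨ cong₂ _*_ (cong signPow kOf≡v+w) coeff-det-hMatrix-[v,w] ⟩
      parity (m + w) * (parity w * (B * (parity (suc m) * Y)))
        ≡⟨ cong₂ (λ p q → p * (parity w * (B * (q * Y)))) (parity-+ m w) (parity-suc m) ⟩
      (parity m * parity w) * (parity w * (B * ((- parity m) * Y)))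
        ≡⟨ signs (parity m) (parity w) B Y ⟩
      - ((parity m * parity m) * ((parity w * parity w) * (B * Y)))
        ≡⟨ cong₂ (λ p q → - (p * (q * (B * Y)))) (parity²≡1 m) (parity²≡1 w) ⟩
      - (1ℤ * (1ℤ * (B * Y)))
        ≡⟨ cong -_ (trans (ℤP.*-identityˡ _) (ℤP.*-identityˡ _)) ⟩
      - (B * Y)
        ∎
    nonzero : - (B * Y) ≢ 0ℤ
    nonzero = difference-product≢0
      (distinct⇒y-distinct (distinct fzero (fsuc fzero) (λ ()))
                           (trans (size-low fzero z≤n) (sym (size-low (fsuc fzero) (s≤s z≤n)))))
      (distinct⇒y-distinct (distinct _ _ p₁≢p₂) (trans σr₁≡ (sym σr₂≡)))
    small : Small v (det (suc (suc w)) A)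
    small = Small-det-hMatrix (suc (suc w)) b σ toℕ (suc d) p₁≢p₂ σr₁≡ σr₂≡ FinP.toℕ-injective
      (λ c → subst (toℕ c ≤_) (sym a+v≡) (ℕ.s≤s⁻¹ (FinP.toℕ<n c)))
    above-vanishes : ∀ μ → IsMonomial μ → weight μ ≡ v + w → (v ∷ w ∷ []) <M μ →
      coeff (φ (suc (suc w)) D) μ ≡ 0ℤ
    above-vanishes μ μ-ok wt above = begin
      coeff (φ (suc (suc w)) D) μ
        ≡⟨ coeff-scaleP sign (det _ A) μ ⟩
      sign * coeff (det _ A) μ
        ≡⟨ cong (sign *_) (coeff-Small small (above-[v,w]⇒All-v< μ μ-ok wt above)) ⟩
      sign * 0ℤ
        ≡⟨ ℤP.*-zeroʳ sign ⟩
      0ℤ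
        ∎
      where
      sign : ℤ
      sign = signPow (kOf (suc (suc w)) D)

-- We write v = m + 2 and w = d + m + 1, and bring the size w + 2
-- into the form suc (suc w).
lemma5p12 : (v w : ℕ) → 2 ≤ v → v ≤ w →
    (D : Fin (w + 2) → Point) →
    In𝔇' (w + 2) D →
    (∀ i j → i ≢ j → D i ≢ D j) →
    (∀ i → suc (toℕ i) ≤ 2 → ∣ D i ∣P ≡ + 0) →
    (∀ i → 3 ≤ suc (toℕ i) → suc (toℕ i) ≤ w ∸ v + 3 → ∣ D i ∣P ≡ + (suc (toℕ i) ∸ 2)) →
    (∀ i → w ∸ v + 4 ≤ suc (toℕ i) → ∣ D i ∣P ≡ + (suc (toℕ i) ∸ 3)) →
    (coeff (φ (w + 2) D) (v ∷ w ∷ [])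
        ≡ - ((yAt D 1 - yAt D 2) * (yAt D (w ∸ v + 3) - yAt D (w ∸ v + 4))))
    × (- ((yAt D 1 - yAt D 2) * (yAt D (w ∸ v + 3) - yAt D (w ∸ v + 4))) ≢ + 0)
    × (∀ μ → IsMonomial μ → weight μ ≡ v + w → (v ∷ w ∷ []) <M μ → coeff (φ (w + 2) D) μ ≡ + 0)
lemma5p12 (suc (suc m)) (suc w) (s≤s (s≤s z≤n)) (s≤s v≤w) D _ distinct H₁ H₂ H₃
  with d , refl ← map₂ (trans (ℕP.+-comm _ (suc m))) (ℕP.m≤n⇒∃[o]m+o≡n v≤w)
  with d + suc m + 2 | ℕP.+-comm (d + suc m) 2
... | _ | refl rewrite ℕP.m+n∸n≡m d (suc m) =
  φ-leadingTerm m d D distinct (λ i i≤1 → H₁ i (s≤s i≤1)) size-stair size-pair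
  where
  size-stair : ∀ i t → toℕ i ≡ suc (suc t) → t ≤ d → ∣ D i ∣P ≡ + suc t
  size-stair i t i≡ t≤d = trans (H₂ i (subst (λ z → 3 ≤ suc z) (sym i≡) (s≤s (s≤s (s≤s z≤n)))) bound)
                                (cong (λ z → + (suc z ∸ 2)) i≡)
    where
    bound : suc (toℕ i) ≤ d + 3
    bound = subst₂ (λ x y → suc x ≤ y) (sym i≡) (ℕP.+-comm 3 d) (ℕP.+-monoʳ-≤ 3 t≤d)
  size-pair : ∀ i t → toℕ i ≡ suc (suc (suc (d + t))) → ∣ D i ∣P ≡ + suc (d + t)
  size-pair i t i≡ = trans (H₃ i bound) (cong (λ z → + (suc z ∸ 3)) i≡)
    where
    bound : d + 4 ≤ suc (toℕ i)
    bound = subst₂ (λ x y → x ≤ suc y) (ℕP.+-comm 4 d) (sym i≡) (ℕP.+-monoʳ-≤ 4 (ℕP.m≤m+n d t))
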